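{- There exists $N$ such that for all integers $m,n\ge N$ the following holds. Let $\overline{m+4},\overline{n+4}\in\{0,\dots,12\}$ be the residues of $m+4$ and $n+4$ modulo $13$, and let \[\Phi=\{(2,7),(3,9),(4,4),(4,7),(4,10),(6,7),(6,9),(6,11),(7,2),(7,4),(7,6),(9,3),(9,6),(9,9),(10,4),(11,6)\}.\] If $(\overline{m+4},\overline{n+4})\in\Phi$ then \[\gamma_{3,1}(G_{m,n})\le\left\lfloor \frac{(m+4)(n+4)}{13}\right\rfloor-5,\] and otherwise \[\gamma_{3,1}(G_{m,n})\le\left\lfloor \frac{(m+4)(n+4)}{13}\right\rfloor-4.\]
   Context: For positive integers $m,n$, $G_{m,n}$ denotes the $m\times n$ grid graph (the Cartesian product of a path on $m$ vertices and a path on $n$ vertices). For a graph $G=(V,E)$ with shortest-path distance $d$ and integers $1\le r\le t$, the reception strength of $u\in V$ with respect to $S\subseteq V$ is $r(u)=\sum_{v\in S,\ d(u,v)<t}\bigl(t-d(u,v)\bigr)$. A set $S\subseteq V$ is a $(t,r)$ broadcast dominating set if $r(u)\ge r$ for every $u\in V$. The $(t,r)$ broadcast domination number $\gamma_{t,r}(G)$ is the minimum cardinality of a $(t,r)$ broadcast dominating set of $G$. The paper states the result "for any sufficiently large $m$ and $n$". -}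

module Defs where

open import Data.Nat using (ℕ; zero; suc; _+_; _*_; _∸_; _≤_; _<_; _<ᵇ_; _/_)
open import Data.Bool using (if_then_else_)
open import Data.Fin using (Fin; toℕ)
open import Data.Product using (_×_; _,_; Σ; ∃-syntax)
open import Data.List using (List; []; _∷_; length; map)
open import Data.Nat.ListAction using (sum)
open import Data.List.Relation.Unary.Unique.Propositional using (Unique)

∣_-_∣ : ℕ → ℕ → ℕ
∣ a - b ∣ = (a ∸ b) + (b ∸ a)

Vertex : ℕ → ℕ → Set
Vertex m n = Fin m × Fin n

-- shortest-path distance in G_{m,n} (the Manhattan distance)
gridDist : ∀ {m n} → Vertex m n → Vertex m n → ℕ
gridDist (i , j) (i' , j') = ∣ toℕ i - toℕ i' ∣ + ∣ toℕ j - toℕ j' ∣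

contribution : ∀ {m n} → ℕ → Vertex m n → Vertex m n → ℕ
contribution t u v = if gridDist u v <ᵇ t then t ∸ gridDist u v else 0

-- reception strength of u w.r.t. a (duplicate-free list representing the set) S
reception : ∀ {m n} → ℕ → List (Vertex m n) → Vertex m n → ℕ
reception t S u = sum (map (contribution t u) S)

IsBroadcastDominating : ∀ {m n} → ℕ → ℕ → List (Vertex m n) → Set
IsBroadcastDominating {m} {n} t r S = (u : Vertex m n) → r ≤ reception t S u

γ≤ : ℕ → ℕ → ℕ → ℕ → ℕ → Set
γ≤ t r m n k =
  ∃[ S ] (Unique S × IsBroadcastDominating {m} {n} t r S × length S ≤ k)

Φ : List (ℕ × ℕ)
Φ = (2 , 7) ∷ (3 , 9) ∷ (4 , 4) ∷ (4 , 7) ∷ (4 , 10) ∷ (6 , 7) ∷ (6 , 9) ∷ (6 , 11)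
  ∷ (7 , 2) ∷ (7 , 4) ∷ (7 , 6) ∷ (9 , 3) ∷ (9 , 6) ∷ (9 , 9) ∷ (10 , 4) ∷ (11 , 6) ∷ []

base : ℕ → ℕ → ℕ
base m n = ((m + 4) * (n + 4)) / 13

{-# OPTIONS --safe #-}
module Submission where

-- For 35 ≤ m, n < 48 the tower sets are explicit seeds. The 13-point balls of radius 2
-- tile ℤ², centred on a lattice x + 5y + c ≡ 0 (mod 13). Restrict that tiling to the
-- (m + 4) × (n + 4) grid, in which G_{m,n} sits inside a frame of width 2, and move the
-- centres lying in the frame onto the boundary of G_{m,n}: every vertex is then within
-- distance 2 of a tower, hence has reception ≥ 1 for t = 3, and there are about
-- (m + 4)(n + 4)/13 towers; rearranging the towers near the four corners by hand saves
-- the remaining 4 or 5. The 169 seeds are verified by evaluation.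
-- Larger grids arise by inserting a second copy of the 13 rows 10‥22 (or columns): the
-- pattern looks the same within distance 2 on both sides of the band, so coverage is
-- preserved, and the band holds at most n + 4 towers, exactly the increase of
-- ⌊(m + 4)(n + 4)/13⌋ when m grows by 13.

open import Defs
open import Data.Bool using (Bool; true; false; _∧_; _∨_; if_then_else_)
open import Data.Bool.Properties using (T-≡) renaming (_≟_ to _≟ᵇ_)
open import Data.Fin using (toℕ; fromℕ<)
open import Data.Fin.Properties using (toℕ<n; toℕ-fromℕ<)
open import Data.List using (List; []; _∷_; _++_; length; map; downFrom; applyDownFrom; filterᵇ; cartesianProduct; allFin; tabulate)
open import Data.List.Properties using (map-++; map-∘; map-cong; map-tabulate; tabulate-cong)
open import Data.List.Membership.Propositional using (_∈_)
open import Data.List.Membership.Propositional.Properties using (∈-cartesianProduct⁺; ∈-allFin; ∈-filter⁺; ∈-downFrom⁺; ∈-applyDownFrom⁺)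
open import Data.List.Relation.Unary.Any using (here; there)
open import Data.List.Relation.Unary.Unique.Propositional.Properties using (filter⁺; cartesianProduct⁺; allFin⁺)
open import Data.Nat using (ℕ; zero; suc; _+_; _*_; _∸_; _≤_; _<_; _≥_; _<ᵇ_; _≤ᵇ_; _≡ᵇ_; _%_; _/_; z≤n; s≤s; s≤s⁻¹; _<?_)
open import Data.Nat.DivMod using (+-distrib-/-∣ʳ; m*n/n≡m; [m+kn]%n≡m%n; m≡m%n+[m/n]*n; m%n<n)
open import Data.Nat.Divisibility using (divides)
open import Data.Nat.ListAction using (sum)
open import Data.Nat.ListAction.Properties using (sum-++)
open import Data.Nat.Properties
open import Algebra.Properties.CommutativeSemigroup +-commutativeSemigroup using (interchange; xy∙z≈xz∙y)
open import Data.Nat.Solver using (module +-*-Solver)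
open import Data.Product using (Σ; _×_; _,_; proj₁; proj₂; ∃; ∃-syntax)
open import Data.Product.Properties using (≡-dec)
open import Data.List.Membership.DecPropositional (≡-dec _≟_ _≟_) using (_∈?_)
open import Function using (_∘_; Equivalence)
open import Relation.Binary.PropositionalEquality
open import Relation.Nullary using (¬_; yes; no; does)
open import Relation.Nullary.Decidable using (T?; isYes; toWitness; dec-true; dec-false)

sumFrom : (ℕ → ℕ) → ℕ → ℕ → ℕ
sumFrom f s zero    = 0
sumFrom f s (suc l) = f s + sumFrom f (suc s) l

sumFrom-split : ∀ f s a b → sumFrom f s (a + b) ≡ sumFrom f s a + sumFrom f (s + a) b
sumFrom-split f s zero    b = cong (λ s′ → sumFrom f s′ b) (sym (+-identityʳ s))
sumFrom-split f s (suc a) b = begin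
  f s + sumFrom f (suc s) (a + b)                       ≡⟨ cong (f s +_) (sumFrom-split f (suc s) a b) ⟩
  f s + (sumFrom f (suc s) a + sumFrom f (suc s + a) b) ≡⟨ cong (λ s′ → f s + (sumFrom f (suc s) a + sumFrom f s′ b)) (sym (+-suc s a)) ⟩
  f s + (sumFrom f (suc s) a + sumFrom f (s + suc a) b) ≡⟨ +-assoc (f s) _ _ ⟨
  f s + sumFrom f (suc s) a + sumFrom f (s + suc a) b   ∎
  where open ≡-Reasoning

sumFrom-cong : ∀ f g s s′ l → (∀ {t} → t < l → f (s + t) ≡ g (s′ + t)) → sumFrom f s l ≡ sumFrom g s′ l
sumFrom-cong f g s s′ zero    eq = refl
sumFrom-cong f g s s′ (suc l) eq = cong₂ _+_ first rest
  where
  first : f s ≡ g s′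
  first = subst₂ (λ a b → f a ≡ g b) (+-identityʳ s) (+-identityʳ s′) (eq (s≤s z≤n))
  rest : sumFrom f (suc s) l ≡ sumFrom g (suc s′) l
  rest = sumFrom-cong f g (suc s) (suc s′) l (λ {t} t<l →
    subst₂ (λ a b → f a ≡ g b) (+-suc s t) (+-suc s′ t) (eq (s≤s t<l)))

sumFrom-distrib-+ : ∀ f g s l → sumFrom (λ t → f t + g t) s l ≡ sumFrom f s l + sumFrom g s l
sumFrom-distrib-+ f g s zero    = refl
sumFrom-distrib-+ f g s (suc l) = trans (cong (f s + g s +_) (sumFrom-distrib-+ f g (suc s) l))
  (interchange (f s) (g s) (sumFrom f (suc s) l) (sumFrom g (suc s) l))

sumFrom-zero : ∀ s l → sumFrom (λ _ → 0) s l ≡ 0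
sumFrom-zero s zero    = refl
sumFrom-zero s (suc l) = sumFrom-zero (suc s) l

sumFrom-comm : ∀ (f : ℕ → ℕ → ℕ) i₀ h j₀ w →
  sumFrom (λ i → sumFrom (f i) j₀ w) i₀ h ≡ sumFrom (λ j → sumFrom (λ i → f i j) i₀ h) j₀ w
sumFrom-comm f i₀ zero    j₀ w = sym (sumFrom-zero j₀ w)
sumFrom-comm f i₀ (suc h) j₀ w = trans (cong (sumFrom (f i₀) j₀ w +_) (sumFrom-comm f (suc i₀) h j₀ w))
  (sym (sumFrom-distrib-+ (f i₀) (λ j → sumFrom (λ i → f i j) (suc i₀) h) j₀ w))

-- Tower patterns and coverage

Pattern : Set
Pattern = ℕ → ℕ → Bool

transpose : Pattern → Pattern
transpose P i j = P j i

indicator : Bool → ℕ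
indicator true  = 1
indicator false = 0

rowCount : (ℕ → Bool) → ℕ → ℕ → ℕ
rowCount row j₀ w = sumFrom (indicator ∘ row) j₀ w

count : Pattern → ℕ → ℕ → ℕ → ℕ → ℕ
count P i₀ h j₀ w = sumFrom (λ i → rowCount (P i) j₀ w) i₀ h

count-transpose : ∀ P i₀ h j₀ w → count (transpose P) i₀ h j₀ w ≡ count P j₀ w i₀ h
count-transpose P i₀ h j₀ w = sumFrom-comm (λ i j → indicator (P j i)) i₀ h j₀ w

distance : ℕ → ℕ → ℕ → ℕ → ℕ
distance i j a b = ∣ i - a ∣ + ∣ j - b ∣

∣-∣≤⇒≤+ : ∀ {a b d} → ∣ a - b ∣ ≤ d → a ≤ d + b
∣-∣≤⇒≤+ {a} {b} {d} h = begin
  a           ≤⟨ m≤n+m∸n a b ⟩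
  b + (a ∸ b) ≤⟨ +-monoʳ-≤ b (≤-trans (m≤m+n (a ∸ b) (b ∸ a)) h) ⟩
  b + d       ≡⟨ +-comm b d ⟩
  d + b       ∎
  where open ≤-Reasoning

near⇒row≤ : ∀ {i a} j b → distance i j a b ≤ 2 → a ≤ 2 + i
near⇒row≤ {i} {a} j b d = ∣-∣≤⇒≤+ (≤-trans (≤-reflexive (+-comm (a ∸ i) (i ∸ a))) (≤-trans (m≤m+n ∣ i - a ∣ ∣ j - b ∣) d))

near⇒≤row : ∀ {i a} j b → distance i j a b ≤ 2 → i ≤ 2 + a
near⇒≤row {i} {a} j b d = ∣-∣≤⇒≤+ (≤-trans (m≤m+n ∣ i - a ∣ ∣ j - b ∣) d)

record NearbyTower (m n : ℕ) (P : Pattern) (i j : ℕ) : Set where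
  constructor tower
  field
    {row col} : ℕ
    row<m     : row < m
    col<n     : col < n
    isTower   : P row col ≡ true
    near      : distance i j row col ≤ 2

Covers : ℕ → ℕ → Pattern → Set
Covers m n P = ∀ {i j} → i < m → j < n → NearbyTower m n P i j

transpose-covers : ∀ {m n P} → Covers m n P → Covers n m (transpose P)
transpose-covers cov i<n j<m with tower {a} {b} a<m b<n t d ← cov j<m i<n =
  tower b<n a<m t (subst (_≤ 2) (+-comm ∣ _ - a ∣ ∣ _ - b ∣) d)

_at_ : ∀ {m n} → Pattern → Vertex m n → Bool
P at (i , j) = P (toℕ i) (toℕ j)

towers : (m n : ℕ) → Pattern → List (Vertex m n)
towers m n P = filterᵇ (P at_) (cartesianProduct (allFin m) (allFin n))

length-filterᵇ : ∀ {A : Set} (p : A → Bool) xs → length (filterᵇ p xs) ≡ sum (map (indicator ∘ p) xs)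
length-filterᵇ p []       = refl
length-filterᵇ p (x ∷ xs) with p x
... | true  = cong suc (length-filterᵇ p xs)
... | false = length-filterᵇ p xs

sum-cartesianProduct : ∀ {A B : Set} (f : A × B → ℕ) xs ys →
  sum (map f (cartesianProduct xs ys)) ≡ sum (map (λ x → sum (map (λ y → f (x , y)) ys)) xs)
sum-cartesianProduct f []       ys = refl
sum-cartesianProduct f (x ∷ xs) ys = begin
  sum (map f (map (x ,_) ys ++ cartesianProduct xs ys))
    ≡⟨ cong sum (map-++ f (map (x ,_) ys) _) ⟩
  sum (map f (map (x ,_) ys) ++ map f (cartesianProduct xs ys))
    ≡⟨ sum-++ (map f (map (x ,_) ys)) _ ⟩
  sum (map f (map (x ,_) ys)) + sum (map f (cartesianProduct xs ys))
    ≡⟨ cong₂ _+_ (cong sum (sym (map-∘ ys))) (sum-cartesianProduct f xs ys) ⟩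
  sum (map (λ y → f (x , y)) ys) + sum (map (λ x → sum (map (λ y → f (x , y)) ys)) xs)
    ∎
  where open ≡-Reasoning

sum-tabulate : ∀ n (g : ℕ → ℕ) s → sum (tabulate {n = n} (λ i → g (s + toℕ i))) ≡ sumFrom g s n
sum-tabulate zero    g s = refl
sum-tabulate (suc n) g s = cong₂ _+_ (cong g (+-identityʳ s))
  (trans (cong sum (tabulate-cong {n = n} (λ i → cong g (+-suc s (toℕ i))))) (sum-tabulate n g (suc s)))

sum-allFin : ∀ n (g : ℕ → ℕ) → sum (map (g ∘ toℕ) (allFin n)) ≡ sumFrom g 0 n
sum-allFin n g = trans (cong sum (map-tabulate {n = n} (λ i → i) (g ∘ toℕ))) (sum-tabulate n g 0)

length-towers : ∀ m n P → length (towers m n P) ≡ count P 0 m 0 n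
length-towers m n P = begin
  length (towers m n P)
    ≡⟨ length-filterᵇ (P at_) (cartesianProduct (allFin m) (allFin n)) ⟩
  sum (map (indicator ∘ (P at_)) (cartesianProduct (allFin m) (allFin n)))
    ≡⟨ sum-cartesianProduct (indicator ∘ (P at_)) (allFin m) (allFin n) ⟩
  sum (map (λ i → sum (map (λ j → indicator (P at (i , j))) (allFin n))) (allFin m))
    ≡⟨ cong sum (map-cong (λ i → sum-allFin n (indicator ∘ P (toℕ i))) (allFin m)) ⟩
  sum (map (λ i → rowCount (P (toℕ i)) 0 n) (allFin m))
    ≡⟨ sum-allFin m (λ i → rowCount (P i) 0 n) ⟩
  count P 0 m 0 n
    ∎
  where open ≡-Reasoning

∈⇒≤sum : ∀ {A : Set} (f : A → ℕ) {x} {xs} → x ∈ xs → f x ≤ sum (map f xs)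
∈⇒≤sum f {xs = y ∷ ys} (here refl) = m≤m+n (f y) _
∈⇒≤sum f {xs = y ∷ ys} (there x∈) = ≤-trans (∈⇒≤sum f x∈) (m≤n+m _ (f y))

near⇒1≤contribution : ∀ {m n} (u v : Vertex m n) → gridDist u v ≤ 2 → 1 ≤ contribution 3 u v
near⇒1≤contribution u v d with gridDist u v
... | 0 = s≤s z≤n
... | 1 = s≤s z≤n
... | 2 = s≤s z≤n
near⇒1≤contribution u v (s≤s (s≤s ())) | suc (suc (suc _))

covers⇒dominating : ∀ {m n P} → Covers m n P → IsBroadcastDominating 3 1 (towers m n P)
covers⇒dominating {m} {n} {P} cov u@(i , j) with tower {a} {b} a<m b<n t d ← cov (toℕ<n i) (toℕ<n j) =
  ≤-trans (near⇒1≤contribution u v (subst (_≤ 2) (sym dist-v) d)) (∈⇒≤sum (contribution 3 u) v∈)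
  where
  v : Vertex m n
  v = fromℕ< a<m , fromℕ< b<n
  dist-v : gridDist u v ≡ distance (toℕ i) (toℕ j) a b
  dist-v = cong₂ (λ x y → ∣ toℕ i - x ∣ + ∣ toℕ j - y ∣) (toℕ-fromℕ< a<m) (toℕ-fromℕ< b<n)
  v∈ : v ∈ towers m n P
  v∈ = ∈-filter⁺ (T? ∘ (P at_)) (∈-cartesianProduct⁺ (∈-allFin _) (∈-allFin _))
    (Equivalence.from T-≡ (trans (cong₂ P (toℕ-fromℕ< a<m) (toℕ-fromℕ< b<n)) t))

covers⇒γ≤ : ∀ {m n P k} → Covers m n P → count P 0 m 0 n ≤ k → γ≤ 3 1 m n k
covers⇒γ≤ {m} {n} {P} cov ≤k =
  towers m n P ,
  filter⁺ (T? ∘ (P at_)) (cartesianProduct⁺ (allFin⁺ m) (allFin⁺ n)) ,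
  covers⇒dominating cov ,
  subst (_≤ _) (sym (length-towers m n P)) ≤k

-- Inserting a band of 13 rows

-- Rows 8‥11 reappear as rows 21‥24, so within distance 2 the band 10‥22 is bordered alike on
-- both sides: a copy of it can be inserted after row 22 without disturbing coverage.
RowPeriodic : ℕ → Pattern → Set
RowPeriodic n P = ∀ {x j} → 8 ≤ x → x < 12 → j < n → P x j ≡ P (13 + x) j

insertBand : Pattern → Pattern
insertBand P i = if does (i <? 23) then P i else P (i ∸ 13)

insertBand-< : ∀ P {i} → i < 23 → insertBand P i ≡ P i
insertBand-< P {i} i<23 = cong (λ b → if b then P i else P (i ∸ 13)) (dec-true (i <? 23) i<23)

insertBand-≥ : ∀ P {i} → 23 ≤ i → insertBand P i ≡ P (i ∸ 13)
insertBand-≥ P {i} 23≤i = cong (λ b → if b then P i else P (i ∸ 13)) (dec-false (i <? 23) (≤⇒≯ 23≤i))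

insertBand-row : ∀ P {m i} → 23 ≤ m → i < m + 13 → ∃[ i′ ] i′ < m × insertBand P i ≡ P i′
insertBand-row P {m} {i} 23≤m i<m+13 with i <? 23
... | yes i<23 = i , <-≤-trans i<23 23≤m , insertBand-< P i<23
... | no  i≮23 = i ∸ 13 , i∸13<m , insertBand-≥ P (≮⇒≥ i≮23)
  where
  i∸13<m : i ∸ 13 < m
  i∸13<m = subst (i ∸ 13 <_) (m+n∸n≡m m 13) (∸-monoˡ-< i<m+13 (≤-trans (m≤m+n 13 10) (≮⇒≥ i≮23)))

module _ {n P} (periodic : RowPeriodic n P) where

  insertBand-low : ∀ {x j} → x < 25 → j < n → insertBand P x j ≡ P x j
  insertBand-low {x} {j} x<25 j<n with x <? 23
  ... | yes x<23 = cong-app (insertBand-< P x<23) j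
  ... | no  x≮23 = begin
    insertBand P x j       ≡⟨ cong-app (insertBand-≥ P 23≤x) j ⟩
    P (x ∸ 13) j           ≡⟨ periodic (≤-trans (m≤m+n 8 2) (∸-monoˡ-≤ 13 23≤x)) (∸-monoˡ-< x<25 13≤x) j<n ⟩
    P (13 + (x ∸ 13)) j    ≡⟨ cong (λ i → P i j) (m+[n∸m]≡n 13≤x) ⟩
    P x j                  ∎
    where
    open ≡-Reasoning
    23≤x : 23 ≤ x
    23≤x = ≮⇒≥ x≮23
    13≤x : 13 ≤ x
    13≤x = ≤-trans (m≤m+n 13 10) 23≤x

  insertBand-high : ∀ {y j} → 8 ≤ y → j < n → insertBand P (13 + y) j ≡ P y j
  insertBand-high {y} {j} 8≤y j<n with y <? 10
  ... | yes y<10 = trans (cong-app (insertBand-< P (+-monoʳ-< 13 y<10)) j)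
                         (sym (periodic 8≤y (≤-trans y<10 (m≤m+n 10 2)) j<n))
  ... | no  y≮10 = cong-app (insertBand-≥ P (+-monoʳ-≤ 13 (≮⇒≥ y≮10))) j

  insertBand-rowPeriodic : RowPeriodic n (insertBand P)
  insertBand-rowPeriodic 8≤x x<12 j<n =
    trans (insertBand-low (≤-trans x<12 (m≤m+n 12 13)) j<n) (sym (insertBand-high 8≤x j<n))

  insertBand-covers : ∀ {m} → 23 ≤ m → Covers m n P → Covers (m + 13) n (insertBand P)
  insertBand-covers {m} 23≤m cov {i} {j} i<m+13 j<n with i <? 23
  ... | yes i<23 = keep (cov (<-≤-trans i<23 23≤m) j<n)
    where
    keep : NearbyTower m n P i j → NearbyTower (m + 13) n (insertBand P) i j
    keep (tower {col = b} a<m b<n t d) = tower (≤-trans a<m (m≤m+n m 13)) b<n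
      (trans (insertBand-low (≤-<-trans (near⇒row≤ j b d) (+-monoʳ-< 2 i<23)) b<n) t) d
  ... | no  i≮23 = subst (λ i → NearbyTower (m + 13) n (insertBand P) i j) (m+[n∸m]≡n 13≤i)
                     (shift (cov i∸13<m j<n))
    where
    13≤i : 13 ≤ i
    13≤i = ≤-trans (m≤m+n 13 10) (≮⇒≥ i≮23)
    i∸13<m : i ∸ 13 < m
    i∸13<m = subst (i ∸ 13 <_) (m+n∸n≡m m 13) (∸-monoˡ-< i<m+13 13≤i)
    shift : NearbyTower m n P (i ∸ 13) j → NearbyTower (m + 13) n (insertBand P) (13 + (i ∸ 13)) j
    shift (tower {a} {b} a<m b<n t d) = tower (subst (13 + a <_) (+-comm 13 m) (+-monoʳ-< 13 a<m)) b<n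
      (trans (insertBand-high 8≤a b<n) t) d
      where
      8≤a : 8 ≤ a
      8≤a = s≤s⁻¹ (s≤s⁻¹ (≤-trans (∸-monoˡ-≤ 13 (≮⇒≥ i≮23)) (near⇒≤row j b d)))

insertBand-colPeriodic : ∀ {m P} → 23 ≤ m → RowPeriodic m (transpose P) → RowPeriodic (m + 13) (transpose (insertBand P))
insertBand-colPeriodic {m} {P} 23≤m periodic {y} {i} 8≤y y<12 i<m+13
  with i′ , i′<m , eq ← insertBand-row P 23≤m i<m+13 = begin
  insertBand P i y        ≡⟨ cong-app eq y ⟩
  P i′ y                  ≡⟨ periodic 8≤y y<12 i′<m ⟩
  P i′ (13 + y)           ≡⟨ cong-app eq (13 + y) ⟨
  insertBand P i (13 + y) ∎
  where open ≡-Reasoning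

count-insertBand : ∀ P {m} j₀ w → 10 ≤ m → count (insertBand P) 0 (m + 13) j₀ w ≡ count P 0 m j₀ w + count P 10 13 j₀ w
count-insertBand P {m} j₀ w 10≤m with k , refl ← m≤n⇒∃[o]m+o≡n 10≤m = begin
  sumFrom R 0 (10 + k + 13)                        ≡⟨ cong (sumFrom R 0) (+-comm (10 + k) 13) ⟩
  sumFrom R 0 (23 + k)                             ≡⟨ sumFrom-split R 0 23 k ⟩
  sumFrom R 0 23 + sumFrom R 23 k                  ≡⟨ cong₂ _+_ (sumFrom-cong R Q 0 0 23 (cong rows ∘ insertBand-< P))
                                                                (sumFrom-cong R Q 23 10 k (λ _ → cong rows (insertBand-≥ P (m≤m+n 23 _)))) ⟩
  sumFrom Q 0 23 + sumFrom Q 10 k                  ≡⟨ cong (_+ sumFrom Q 10 k) (sumFrom-split Q 0 10 13) ⟩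
  sumFrom Q 0 10 + sumFrom Q 10 13 + sumFrom Q 10 k ≡⟨ xy∙z≈xz∙y (sumFrom Q 0 10) _ _ ⟩
  sumFrom Q 0 10 + sumFrom Q 10 k + sumFrom Q 10 13 ≡⟨ cong (_+ sumFrom Q 10 13) (sumFrom-split Q 0 10 k) ⟨
  sumFrom Q 0 (10 + k) + sumFrom Q 10 13           ∎
  where
  open ≡-Reasoning
  rows : (ℕ → Bool) → ℕ
  rows row = rowCount row j₀ w
  R Q : ℕ → ℕ
  R i = rows (insertBand P i)
  Q i = rows (P i)

count-insertBand-band : ∀ P j₀ w → count (insertBand P) 10 13 j₀ w ≡ count P 10 13 j₀ w
count-insertBand-band P j₀ w =
  sumFrom-cong (λ i → rowCount (insertBand P i) j₀ w) (λ i → rowCount (P i) j₀ w) 10 10 13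
    (λ t<13 → cong (λ row → rowCount row j₀ w) (insertBand-< P (+-monoʳ-< 10 t<13)))

base-comm : ∀ m n → base m n ≡ base n m
base-comm m n = cong (_/ 13) (*-comm (m + 4) (n + 4))

base-+13 : ∀ m n → base (m + 13) n ≡ base m n + (n + 4)
base-+13 m n = begin
  (m + 13 + 4) * (n + 4) / 13                    ≡⟨ cong (_/ 13) (expand m n) ⟩
  ((m + 4) * (n + 4) + (n + 4) * 13) / 13        ≡⟨ +-distrib-/-∣ʳ ((m + 4) * (n + 4)) (divides (n + 4) refl) ⟩
  (m + 4) * (n + 4) / 13 + (n + 4) * 13 / 13     ≡⟨ cong (base m n +_) (m*n/n≡m (n + 4) 13) ⟩
  base m n + (n + 4)                             ∎
  where
  open ≡-Reasoning
  open +-*-Solver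
  expand : ∀ m n → (m + 13 + 4) * (n + 4) ≡ (m + 4) * (n + 4) + (n + 4) * 13
  expand = solve 2 (λ m n → (m :+ con 13 :+ con 4) :* (n :+ con 4) := (m :+ con 4) :* (n :+ con 4) :+ (n :+ con 4) :* con 13) refl

record Extendable (δ m n : ℕ) (P : Pattern) : Set where
  field
    covers      : Covers m n P
    rowPeriodic : RowPeriodic n P
    colPeriodic : RowPeriodic m (transpose P)
    budget      : count P 0 m 0 n + δ ≤ base m n
    rowBand     : count P 10 13 0 n ≤ n + 4
    colBand     : count P 0 m 10 13 ≤ m + 4
    bandSquare  : count P 10 13 10 13 ≤ 13
    tall        : 23 ≤ m
    wide        : 23 ≤ n

transpose-extendable : ∀ {δ m n P} → Extendable δ m n P → Extendable δ n m (transpose P)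
transpose-extendable {δ} {m} {n} {P} E = record
  { covers      = transpose-covers covers
  ; rowPeriodic = colPeriodic
  ; colPeriodic = rowPeriodic
  ; budget      = subst₂ (λ c b → c + δ ≤ b) (sym (count-transpose P 0 n 0 m)) (base-comm m n) budget
  ; rowBand     = subst (_≤ m + 4) (sym (count-transpose P 10 13 0 m)) colBand
  ; colBand     = subst (_≤ n + 4) (sym (count-transpose P 0 n 10 13)) rowBand
  ; bandSquare  = subst (_≤ 13) (sym (count-transpose P 10 13 10 13)) bandSquare
  ; tall        = wide
  ; wide        = tall
  }
  where open Extendable E

insertBand-extendable : ∀ {δ m n P} → Extendable δ m n P → Extendable δ (m + 13) n (insertBand P)
insertBand-extendable {δ} {m} {n} {P} E = record
  { covers      = insertBand-covers rowPeriodic tall covers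
  ; rowPeriodic = insertBand-rowPeriodic rowPeriodic
  ; colPeriodic = insertBand-colPeriodic tall colPeriodic
  ; budget      = budget′
  ; rowBand     = subst (_≤ n + 4) (sym (count-insertBand-band P 0 n)) rowBand
  ; colBand     = colBand′
  ; bandSquare  = subst (_≤ 13) (sym (count-insertBand-band P 10 13)) bandSquare
  ; tall        = ≤-trans tall (m≤m+n m 13)
  ; wide        = wide
  }
  where
  open Extendable E
  open ≤-Reasoning
  10≤m : 10 ≤ m
  10≤m = ≤-trans (m≤m+n 10 13) tall
  budget′ : count (insertBand P) 0 (m + 13) 0 n + δ ≤ base (m + 13) n
  budget′ = begin
    count (insertBand P) 0 (m + 13) 0 n + δ      ≡⟨ cong (_+ δ) (count-insertBand P 0 n 10≤m) ⟩
    count P 0 m 0 n + count P 10 13 0 n + δ      ≡⟨ xy∙z≈xz∙y (count P 0 m 0 n) _ δ ⟩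
    count P 0 m 0 n + δ + count P 10 13 0 n      ≤⟨ +-mono-≤ budget rowBand ⟩
    base m n + (n + 4)                           ≡⟨ base-+13 m n ⟨
    base (m + 13) n                              ∎
  colBand′ : count (insertBand P) 0 (m + 13) 10 13 ≤ m + 13 + 4
  colBand′ = begin
    count (insertBand P) 0 (m + 13) 10 13        ≡⟨ count-insertBand P 10 13 10≤m ⟩
    count P 0 m 10 13 + count P 10 13 10 13      ≤⟨ +-mono-≤ colBand bandSquare ⟩
    m + 4 + 13                                   ≡⟨ xy∙z≈xz∙y m 4 13 ⟩
    m + 13 + 4                                   ∎

extendRows : ∀ {δ m n P} a → Extendable δ m n P → ∃ (Extendable δ (m + a * 13) n)
extendRows {δ} {m} {n} {P} zero    E = P , subst (λ m′ → Extendable δ m′ n P) (sym (+-identityʳ m)) E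
extendRows {δ} {m} {n}     (suc a) E =
  subst (λ m′ → ∃ (Extendable δ m′ n)) (+-assoc m 13 (a * 13)) (extendRows a (insertBand-extendable E))

extend : ∀ {δ m n P} a b → Extendable δ m n P → ∃ (Extendable δ (m + a * 13) (n + b * 13))
extend a b E =
  let _ , E₁ = extendRows a E
      Q , E₂ = extendRows b (transpose-extendable E₁)
  in transpose Q , transpose-extendable E₂

extendable⇒γ≤ : ∀ {δ m n P} → Extendable δ m n P → γ≤ 3 1 m n (base m n ∸ δ)
extendable⇒γ≤ {m = m} {n} {P} E = covers⇒γ≤ covers (m+n≤o⇒m≤o∸n (count P 0 m 0 n) budget)
  where open Extendable E

residues : ℕ → ℕ → ℕ × ℕ
residues m n = (m + 4) % 13 , (n + 4) % 13

deficit : ℕ → ℕ → ℕ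
deficit m n = if does (residues m n ∈? Φ) then 5 else 4

deficit-∈ : ∀ m n → residues m n ∈ Φ → deficit m n ≡ 5
deficit-∈ m n ∈Φ = cong (λ b → if b then 5 else 4) (dec-true (residues m n ∈? Φ) ∈Φ)

deficit-∉ : ∀ m n → ¬ residues m n ∈ Φ → deficit m n ≡ 4
deficit-∉ m n ∉Φ = cong (λ b → if b then 5 else 4) (dec-false (residues m n ∈? Φ) ∉Φ)

residue-+*13 : ∀ m a → (m + a * 13 + 4) % 13 ≡ (m + 4) % 13
residue-+*13 m a = trans (cong (_% 13) (xy∙z≈xz∙y m (a * 13) 4)) ([m+kn]%n≡m%n (m + 4) a 13)

deficit-+*13 : ∀ m n a b → deficit (m + a * 13) (n + b * 13) ≡ deficit m n
deficit-+*13 m n a b =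
  cong₂ (λ x y → if does ((x , y) ∈? Φ) then 5 else 4) (residue-+*13 m a) (residue-+*13 n b)

-- Data.Bool.ListAction.all and any by direct recursion, which the type checker evaluates markedly faster.
allᵇ : {A : Set} → (A → Bool) → List A → Bool
allᵇ p []       = true
allᵇ p (x ∷ xs) = p x ∧ allᵇ p xs

anyᵇ : {A : Set} → (A → Bool) → List A → Bool
anyᵇ p []       = false
anyᵇ p (x ∷ xs) = p x ∨ anyᵇ p xs

∧-split : ∀ x {y} → x ∧ y ≡ true → x ≡ true × y ≡ true
∧-split true eq = refl , eq

allᵇ-sound : ∀ {A : Set} (p : A → Bool) xs → allᵇ p xs ≡ true → ∀ {x} → x ∈ xs → p x ≡ true
allᵇ-sound p (y ∷ ys) ok (here refl) = proj₁ (∧-split (p y) ok)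
allᵇ-sound p (y ∷ ys) ok (there x∈) = allᵇ-sound p ys (proj₂ (∧-split (p y) ok)) x∈

anyᵇ-sound : ∀ {A : Set} (p : A → Bool) xs → anyᵇ p xs ≡ true → ∃ λ x → p x ≡ true
anyᵇ-sound p (y ∷ ys) ok with p y in eq
... | true  = y , eq
... | false = anyᵇ-sound p ys ok

-- Candidate positions only: soundness re-checks bounds and distance, so clipping by ∸ is harmless.
diamond : ℕ → ℕ → List (ℕ × ℕ)
diamond i j = (i , j) ∷ (suc i , j) ∷ (i ∸ 1 , j) ∷ (i , suc j) ∷ (i , j ∸ 1) ∷ (i + 2 , j) ∷ (i ∸ 2 , j)
  ∷ (i , j + 2) ∷ (i , j ∸ 2) ∷ (suc i , suc j) ∷ (suc i , j ∸ 1) ∷ (i ∸ 1 , suc j) ∷ (i ∸ 1 , j ∸ 1) ∷ []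

isNearbyTowerᵇ : ℕ → ℕ → Pattern → ℕ → ℕ → ℕ × ℕ → Bool
isNearbyTowerᵇ m n P i j (a , b) = (a <ᵇ m) ∧ ((b <ᵇ n) ∧ ((distance i j a b ≤ᵇ 2) ∧ P a b))

nearbyTowerᵇ : ℕ → ℕ → Pattern → ℕ → ℕ → Bool
nearbyTowerᵇ m n P i j = anyᵇ (isNearbyTowerᵇ m n P i j) (diamond i j)

coversᵇ : ℕ → ℕ → Pattern → Bool
coversᵇ m n P = allᵇ (λ i → allᵇ (nearbyTowerᵇ m n P i) (downFrom n)) (downFrom m)

rowsAgreeᵇ : ℕ → Pattern → ℕ → Bool
rowsAgreeᵇ n P x = allᵇ (λ j → isYes (P x j ≟ᵇ P (13 + x) j)) (downFrom n)

rowPeriodicᵇ : ℕ → Pattern → Bool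
rowPeriodicᵇ n P = allᵇ (rowsAgreeᵇ n P) (applyDownFrom (8 +_) 4)

extendableᵇ : ℕ → ℕ → ℕ → Pattern → Bool
extendableᵇ δ m n P = coversᵇ m n P ∧ (rowPeriodicᵇ n P ∧ (rowPeriodicᵇ m (transpose P) ∧
  ((count P 0 m 0 n + δ ≤ᵇ base m n) ∧ ((count P 10 13 0 n ≤ᵇ n + 4) ∧
  ((count P 0 m 10 13 ≤ᵇ m + 4) ∧ (count P 10 13 10 13 ≤ᵇ 13))))))

≤ᵇ-sound : ∀ a b → (a ≤ᵇ b) ≡ true → a ≤ b
≤ᵇ-sound a b ok = ≤ᵇ⇒≤ a b (Equivalence.from T-≡ ok)

<ᵇ-sound : ∀ a b → (a <ᵇ b) ≡ true → a < b
<ᵇ-sound a b ok = <ᵇ⇒< a b (Equivalence.from T-≡ ok)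

isNearbyTowerᵇ-sound : ∀ {m n P i j} ab → isNearbyTowerᵇ m n P i j ab ≡ true → NearbyTower m n P i j
isNearbyTowerᵇ-sound {m} {n} {P} {i} {j} (a , b) ok =
  let a<m  , ok₁ = ∧-split (a <ᵇ m) ok
      b<n  , ok₂ = ∧-split (b <ᵇ n) ok₁
      near , t   = ∧-split (distance i j a b ≤ᵇ 2) ok₂
  in tower (<ᵇ-sound a m a<m) (<ᵇ-sound b n b<n) t (≤ᵇ-sound (distance i j a b) 2 near)

coversᵇ-sound : ∀ {m n P} → coversᵇ m n P ≡ true → Covers m n P
coversᵇ-sound {m} {n} {P} ok {i} {j} i<m j<n =
  isNearbyTowerᵇ-sound _ (proj₂ (anyᵇ-sound (isNearbyTowerᵇ m n P i j) (diamond i j) near))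
  where
  row : allᵇ (nearbyTowerᵇ m n P i) (downFrom n) ≡ true
  row = allᵇ-sound (λ i → allᵇ (nearbyTowerᵇ m n P i) (downFrom n)) (downFrom m) ok (∈-downFrom⁺ i<m)
  near : nearbyTowerᵇ m n P i j ≡ true
  near = allᵇ-sound (nearbyTowerᵇ m n P i) (downFrom n) row (∈-downFrom⁺ j<n)

rowPeriodicᵇ-sound : ∀ {n P} → rowPeriodicᵇ n P ≡ true → RowPeriodic n P
rowPeriodicᵇ-sound {n} {P} ok {x} {j} 8≤x x<12 j<n = toWitness {a? = P x j ≟ᵇ P (13 + x) j}
  (Equivalence.from T-≡ (allᵇ-sound (λ j → isYes (P x j ≟ᵇ P (13 + x) j)) (downFrom n) agree (∈-downFrom⁺ j<n)))
  where
  x∈ : x ∈ applyDownFrom (8 +_) 4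
  x∈ = subst (_∈ applyDownFrom (8 +_) 4) (m+[n∸m]≡n 8≤x) (∈-applyDownFrom⁺ (8 +_) (∸-monoˡ-< x<12 8≤x))
  agree : rowsAgreeᵇ n P x ≡ true
  agree = allᵇ-sound (rowsAgreeᵇ n P) (applyDownFrom (8 +_) 4) ok x∈

extendableᵇ-sound : ∀ {δ m n P} → 23 ≤ m → 23 ≤ n → extendableᵇ δ m n P ≡ true → Extendable δ m n P
extendableᵇ-sound {δ} {m} {n} {P} tall wide ok =
  let cov , ok₁ = ∧-split (coversᵇ m n P) ok
      rp  , ok₂ = ∧-split (rowPeriodicᵇ n P) ok₁
      cp  , ok₃ = ∧-split (rowPeriodicᵇ m (transpose P)) ok₂
      bu  , ok₄ = ∧-split (count P 0 m 0 n + δ ≤ᵇ base m n) ok₃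
      rb  , ok₅ = ∧-split (count P 10 13 0 n ≤ᵇ n + 4) ok₄
      cb  , sq  = ∧-split (count P 0 m 10 13 ≤ᵇ m + 4) ok₅
  in record
    { covers      = coversᵇ-sound {m} {n} {P} cov
    ; rowPeriodic = rowPeriodicᵇ-sound {n} {P} rp
    ; colPeriodic = rowPeriodicᵇ-sound {m} {transpose P} cp
    ; budget      = ≤ᵇ-sound (count P 0 m 0 n + δ) (base m n) bu
    ; rowBand     = ≤ᵇ-sound (count P 10 13 0 n) (n + 4) rb
    ; colBand     = ≤ᵇ-sound (count P 0 m 10 13) (m + 4) cb
    ; bandSquare  = ≤ᵇ-sound (count P 10 13 10 13) 13 sq
    ; tall        = tall
    ; wide        = wide
    }

-- Seed patterns

latticeTower : ℕ → ℕ → ℕ → Bool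
latticeTower c x y = (x + 5 * y + c) % 13 ≡ᵇ 0

-- The coordinates of the (m + 4)-grid that are moved onto row i of the m-grid.
frameFibre : ℕ → ℕ → List ℕ
frameFibre m i =
  if i ≡ᵇ 0 then 0 ∷ 1 ∷ 2 ∷ []
  else if i ≡ᵇ m ∸ 1 then i + 2 ∷ i + 3 ∷ i + 4 ∷ []
  else i + 2 ∷ []

projectedLattice : ℕ → ℕ → ℕ → Pattern
projectedLattice m n c i j = anyᵇ (λ x → anyᵇ (latticeTower c x) (frameFibre n j)) (frameFibre m i)

nearCorner : ℕ → ℕ → Bool
nearCorner p q = ((p ≤ᵇ 2) ∧ (q ≤ᵇ 7)) ∨ ((q ≤ᵇ 2) ∧ (p ≤ᵇ 7))

cornerRegion : ℕ → ℕ → Pattern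
cornerRegion m n i j =
  nearCorner i j ∨ nearCorner i (n ∸ 1 ∸ j) ∨ nearCorner (m ∸ 1 ∸ i) j ∨ nearCorner (m ∸ 1 ∸ i) (n ∸ 1 ∸ j)

_∈ᵇ_ : ℕ × ℕ → List (ℕ × ℕ) → Bool
(i , j) ∈ᵇ ps = anyᵇ (λ p → (proj₁ p ≡ᵇ i) ∧ (proj₂ p ≡ᵇ j)) ps

seedPattern : ℕ → ℕ → ℕ × List (ℕ × ℕ) → Pattern
seedPattern m n (c , corners) i j =
  if cornerRegion m n i j then (i , j) ∈ᵇ corners else projectedLattice m n c i j

-- The lattice offset c and the corner towers of the (35 + r) × (35 + s) seed.
seed : ℕ → ℕ → ℕ × List (ℕ × ℕ)
seed 0 0 = 1 , (0 , 1) ∷ (0 , 34) ∷ (1 , 5) ∷ (1 , 30) ∷ (3 , 2) ∷ (3 , 32) ∷ (4 , 0) ∷ (6 , 34) ∷ (29 , 2) ∷ (30 , 0) ∷ (30 , 33) ∷ (30 , 34) ∷ (32 , 4) ∷ (32 , 30) ∷ (34 , 1) ∷ (34 , 5) ∷ (34 , 27) ∷ (34 , 33) ∷ []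
seed 0 1 = 1 , (0 , 1) ∷ (0 , 31) ∷ (1 , 5) ∷ (1 , 31) ∷ (1 , 35) ∷ (3 , 2) ∷ (4 , 0) ∷ (4 , 33) ∷ (6 , 34) ∷ (29 , 2) ∷ (29 , 35) ∷ (30 , 0) ∷ (30 , 33) ∷ (31 , 35) ∷ (32 , 4) ∷ (32 , 30) ∷ (34 , 1) ∷ (34 , 5) ∷ (34 , 33) ∷ []
seed 0 2 = 1 , (0 , 1) ∷ (0 , 31) ∷ (0 , 34) ∷ (1 , 5) ∷ (1 , 31) ∷ (3 , 2) ∷ (3 , 36) ∷ (4 , 0) ∷ (7 , 35) ∷ (28 , 36) ∷ (29 , 2) ∷ (30 , 0) ∷ (32 , 4) ∷ (32 , 30) ∷ (32 , 36) ∷ (34 , 1) ∷ (34 , 5) ∷ (34 , 33) ∷ []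
seed 0 3 = 1 , (0 , 1) ∷ (0 , 35) ∷ (1 , 5) ∷ (1 , 31) ∷ (2 , 36) ∷ (3 , 2) ∷ (4 , 0) ∷ (4 , 37) ∷ (7 , 35) ∷ (29 , 2) ∷ (29 , 35) ∷ (30 , 0) ∷ (32 , 4) ∷ (32 , 30) ∷ (32 , 31) ∷ (32 , 37) ∷ (34 , 1) ∷ (34 , 5) ∷ (34 , 34) ∷ []
seed 0 4 = 0 , (0 , 2) ∷ (0 , 34) ∷ (1 , 38) ∷ (2 , 5) ∷ (2 , 31) ∷ (2 , 35) ∷ (3 , 0) ∷ (4 , 2) ∷ (5 , 0) ∷ (5 , 37) ∷ (28 , 1) ∷ (28 , 38) ∷ (29 , 36) ∷ (30 , 2) ∷ (31 , 36) ∷ (33 , 0) ∷ (33 , 4) ∷ (34 , 4) ∷ (34 , 34) ∷ (34 , 38) ∷ []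
seed 0 5 = 1 , (0 , 1) ∷ (0 , 35) ∷ (1 , 5) ∷ (1 , 39) ∷ (2 , 36) ∷ (3 , 2) ∷ (4 , 0) ∷ (5 , 38) ∷ (29 , 2) ∷ (30 , 0) ∷ (30 , 38) ∷ (32 , 4) ∷ (32 , 36) ∷ (34 , 1) ∷ (34 , 5) ∷ (34 , 33) ∷ (34 , 39) ∷ []
seed 0 6 = 1 , (0 , 1) ∷ (0 , 35) ∷ (0 , 39) ∷ (1 , 5) ∷ (2 , 36) ∷ (3 , 2) ∷ (4 , 0) ∷ (4 , 40) ∷ (5 , 38) ∷ (29 , 2) ∷ (30 , 0) ∷ (30 , 40) ∷ (31 , 38) ∷ (32 , 4) ∷ (33 , 35) ∷ (34 , 1) ∷ (34 , 5) ∷ (34 , 39) ∷ []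
seed 0 7 = 1 , (0 , 1) ∷ (0 , 35) ∷ (0 , 41) ∷ (1 , 5) ∷ (2 , 36) ∷ (2 , 38) ∷ (3 , 2) ∷ (4 , 0) ∷ (4 , 41) ∷ (29 , 2) ∷ (29 , 41) ∷ (30 , 0) ∷ (31 , 41) ∷ (32 , 4) ∷ (33 , 35) ∷ (34 , 1) ∷ (34 , 5) ∷ (34 , 39) ∷ []
seed 0 8 = 1 , (0 , 1) ∷ (0 , 42) ∷ (1 , 5) ∷ (1 , 38) ∷ (2 , 36) ∷ (2 , 40) ∷ (3 , 2) ∷ (4 , 0) ∷ (5 , 42) ∷ (28 , 42) ∷ (29 , 2) ∷ (30 , 0) ∷ (30 , 40) ∷ (32 , 4) ∷ (33 , 35) ∷ (33 , 42) ∷ (34 , 1) ∷ (34 , 5) ∷ (34 , 38) ∷ []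
seed 0 9 = 1 , (0 , 1) ∷ (0 , 39) ∷ (1 , 5) ∷ (1 , 43) ∷ (2 , 36) ∷ (2 , 40) ∷ (3 , 2) ∷ (4 , 0) ∷ (5 , 42) ∷ (28 , 43) ∷ (29 , 2) ∷ (29 , 41) ∷ (30 , 0) ∷ (31 , 41) ∷ (32 , 4) ∷ (34 , 1) ∷ (34 , 5) ∷ (34 , 39) ∷ (34 , 43) ∷ []
seed 0 10 = 1 , (0 , 1) ∷ (0 , 39) ∷ (0 , 43) ∷ (1 , 5) ∷ (3 , 2) ∷ (4 , 0) ∷ (4 , 44) ∷ (6 , 43) ∷ (27 , 44) ∷ (29 , 2) ∷ (30 , 0) ∷ (30 , 43) ∷ (32 , 4) ∷ (33 , 41) ∷ (34 , 1) ∷ (34 , 5) ∷ (34 , 39) ∷ (34 , 44) ∷ []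
seed 0 11 = 1 , (0 , 1) ∷ (0 , 39) ∷ (0 , 43) ∷ (1 , 5) ∷ (3 , 2) ∷ (3 , 45) ∷ (4 , 0) ∷ (6 , 43) ∷ (27 , 44) ∷ (29 , 2) ∷ (30 , 0) ∷ (30 , 45) ∷ (32 , 4) ∷ (32 , 43) ∷ (34 , 1) ∷ (34 , 5) ∷ (34 , 40) ∷ (34 , 45) ∷ []
seed 0 12 = 1 , (0 , 1) ∷ (0 , 39) ∷ (0 , 43) ∷ (0 , 46) ∷ (1 , 5) ∷ (3 , 2) ∷ (3 , 44) ∷ (4 , 0) ∷ (5 , 46) ∷ (27 , 44) ∷ (29 , 2) ∷ (30 , 0) ∷ (30 , 46) ∷ (32 , 4) ∷ (32 , 43) ∷ (34 , 1) ∷ (34 , 5) ∷ (34 , 40) ∷ (34 , 46) ∷ []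
seed 1 0 = 1 , (0 , 1) ∷ (0 , 34) ∷ (1 , 5) ∷ (1 , 30) ∷ (3 , 2) ∷ (3 , 32) ∷ (4 , 0) ∷ (6 , 34) ∷ (29 , 2) ∷ (29 , 34) ∷ (31 , 32) ∷ (32 , 0) ∷ (34 , 27) ∷ (34 , 34) ∷ (35 , 2) ∷ (35 , 6) ∷ (35 , 30) ∷ []
seed 1 1 = 1 , (0 , 1) ∷ (0 , 31) ∷ (1 , 5) ∷ (1 , 31) ∷ (1 , 35) ∷ (3 , 2) ∷ (4 , 0) ∷ (4 , 33) ∷ (6 , 34) ∷ (29 , 2) ∷ (29 , 35) ∷ (30 , 33) ∷ (32 , 0) ∷ (32 , 33) ∷ (35 , 2) ∷ (35 , 6) ∷ (35 , 31) ∷ (35 , 35) ∷ []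
seed 1 2 = 1 , (0 , 1) ∷ (0 , 31) ∷ (0 , 34) ∷ (1 , 5) ∷ (1 , 31) ∷ (3 , 2) ∷ (3 , 36) ∷ (4 , 0) ∷ (7 , 35) ∷ (28 , 36) ∷ (29 , 2) ∷ (31 , 35) ∷ (32 , 0) ∷ (34 , 33) ∷ (35 , 2) ∷ (35 , 6) ∷ (35 , 31) ∷ (35 , 36) ∷ []
seed 1 3 = 1 , (0 , 1) ∷ (0 , 35) ∷ (1 , 5) ∷ (1 , 31) ∷ (2 , 36) ∷ (3 , 2) ∷ (4 , 0) ∷ (4 , 37) ∷ (7 , 35) ∷ (28 , 36) ∷ (29 , 2) ∷ (31 , 37) ∷ (32 , 0) ∷ (33 , 35) ∷ (35 , 2) ∷ (35 , 6) ∷ (35 , 32) ∷ (35 , 37) ∷ []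
seed 1 4 = 1 , (0 , 1) ∷ (0 , 34) ∷ (0 , 38) ∷ (1 , 5) ∷ (1 , 31) ∷ (2 , 36) ∷ (3 , 2) ∷ (4 , 0) ∷ (5 , 38) ∷ (28 , 36) ∷ (29 , 2) ∷ (31 , 38) ∷ (32 , 0) ∷ (33 , 35) ∷ (35 , 2) ∷ (35 , 6) ∷ (35 , 32) ∷ (35 , 38) ∷ []
seed 1 5 = 1 , (0 , 1) ∷ (0 , 35) ∷ (1 , 5) ∷ (1 , 39) ∷ (2 , 36) ∷ (3 , 2) ∷ (4 , 0) ∷ (5 , 38) ∷ (29 , 2) ∷ (31 , 38) ∷ (31 , 39) ∷ (32 , 0) ∷ (33 , 35) ∷ (35 , 2) ∷ (35 , 6) ∷ (35 , 32) ∷ (35 , 38) ∷ []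
seed 1 6 = 1 , (0 , 1) ∷ (0 , 35) ∷ (0 , 39) ∷ (1 , 5) ∷ (2 , 36) ∷ (3 , 2) ∷ (4 , 0) ∷ (4 , 40) ∷ (5 , 38) ∷ (29 , 2) ∷ (30 , 40) ∷ (31 , 38) ∷ (32 , 0) ∷ (32 , 40) ∷ (33 , 35) ∷ (35 , 2) ∷ (35 , 6) ∷ (35 , 38) ∷ []
seed 1 7 = 1 , (0 , 1) ∷ (0 , 35) ∷ (0 , 41) ∷ (1 , 5) ∷ (2 , 36) ∷ (2 , 38) ∷ (3 , 2) ∷ (4 , 0) ∷ (4 , 41) ∷ (29 , 2) ∷ (29 , 41) ∷ (32 , 0) ∷ (33 , 35) ∷ (33 , 41) ∷ (35 , 2) ∷ (35 , 6) ∷ (35 , 38) ∷ []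
seed 1 8 = 1 , (0 , 1) ∷ (0 , 42) ∷ (1 , 5) ∷ (1 , 38) ∷ (2 , 36) ∷ (2 , 40) ∷ (3 , 2) ∷ (4 , 0) ∷ (5 , 42) ∷ (29 , 2) ∷ (30 , 40) ∷ (32 , 0) ∷ (33 , 35) ∷ (33 , 36) ∷ (33 , 42) ∷ (35 , 2) ∷ (35 , 6) ∷ (35 , 39) ∷ []
seed 1 9 = 1 , (0 , 1) ∷ (0 , 39) ∷ (1 , 5) ∷ (1 , 43) ∷ (2 , 36) ∷ (2 , 40) ∷ (3 , 2) ∷ (4 , 0) ∷ (5 , 42) ∷ (29 , 2) ∷ (29 , 41) ∷ (31 , 42) ∷ (32 , 0) ∷ (34 , 40) ∷ (35 , 2) ∷ (35 , 6) ∷ (35 , 38) ∷ (35 , 43) ∷ []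
seed 1 10 = 1 , (0 , 1) ∷ (0 , 39) ∷ (0 , 43) ∷ (1 , 5) ∷ (3 , 2) ∷ (4 , 0) ∷ (4 , 44) ∷ (6 , 43) ∷ (29 , 2) ∷ (31 , 43) ∷ (32 , 0) ∷ (33 , 41) ∷ (35 , 2) ∷ (35 , 6) ∷ (35 , 38) ∷ (35 , 44) ∷ []
seed 1 11 = 1 , (0 , 1) ∷ (0 , 39) ∷ (0 , 43) ∷ (1 , 5) ∷ (3 , 2) ∷ (3 , 45) ∷ (4 , 0) ∷ (6 , 43) ∷ (29 , 2) ∷ (31 , 45) ∷ (32 , 0) ∷ (32 , 43) ∷ (34 , 40) ∷ (35 , 2) ∷ (35 , 6) ∷ (35 , 44) ∷ []
seed 1 12 = 1 , (0 , 1) ∷ (0 , 39) ∷ (0 , 43) ∷ (0 , 46) ∷ (1 , 5) ∷ (3 , 2) ∷ (3 , 44) ∷ (4 , 0) ∷ (5 , 46) ∷ (29 , 2) ∷ (30 , 46) ∷ (32 , 0) ∷ (32 , 46) ∷ (34 , 40) ∷ (35 , 2) ∷ (35 , 6) ∷ (35 , 44) ∷ []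
seed 2 0 = 1 , (0 , 1) ∷ (0 , 34) ∷ (1 , 5) ∷ (1 , 30) ∷ (3 , 2) ∷ (3 , 32) ∷ (4 , 0) ∷ (6 , 34) ∷ (29 , 2) ∷ (31 , 32) ∷ (32 , 0) ∷ (34 , 1) ∷ (34 , 27) ∷ (34 , 28) ∷ (34 , 34) ∷ (35 , 6) ∷ (36 , 2) ∷ (36 , 31) ∷ []
seed 2 1 = 1 , (0 , 1) ∷ (0 , 31) ∷ (1 , 5) ∷ (1 , 31) ∷ (1 , 35) ∷ (3 , 2) ∷ (4 , 0) ∷ (4 , 33) ∷ (6 , 34) ∷ (29 , 2) ∷ (30 , 33) ∷ (32 , 0) ∷ (32 , 34) ∷ (34 , 1) ∷ (35 , 6) ∷ (35 , 32) ∷ (36 , 2) ∷ (36 , 30) ∷ (36 , 35) ∷ []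
seed 2 2 = 1 , (0 , 1) ∷ (0 , 31) ∷ (0 , 34) ∷ (1 , 5) ∷ (1 , 31) ∷ (3 , 2) ∷ (3 , 36) ∷ (4 , 0) ∷ (7 , 35) ∷ (29 , 2) ∷ (32 , 0) ∷ (32 , 35) ∷ (34 , 1) ∷ (34 , 33) ∷ (35 , 6) ∷ (36 , 2) ∷ (36 , 30) ∷ (36 , 36) ∷ []
seed 2 3 = 1 , (0 , 1) ∷ (0 , 35) ∷ (1 , 5) ∷ (1 , 31) ∷ (2 , 36) ∷ (3 , 2) ∷ (4 , 0) ∷ (4 , 37) ∷ (7 , 35) ∷ (29 , 2) ∷ (32 , 0) ∷ (32 , 37) ∷ (33 , 35) ∷ (34 , 1) ∷ (35 , 6) ∷ (35 , 32) ∷ (36 , 2) ∷ (36 , 36) ∷ []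
seed 2 4 = 0 , (0 , 2) ∷ (0 , 34) ∷ (1 , 38) ∷ (2 , 5) ∷ (2 , 31) ∷ (2 , 35) ∷ (3 , 0) ∷ (4 , 2) ∷ (5 , 0) ∷ (5 , 37) ∷ (29 , 36) ∷ (30 , 2) ∷ (32 , 38) ∷ (33 , 0) ∷ (34 , 35) ∷ (36 , 2) ∷ (36 , 6) ∷ (36 , 32) ∷ (36 , 38) ∷ []
seed 2 5 = 1 , (0 , 1) ∷ (0 , 35) ∷ (1 , 5) ∷ (1 , 39) ∷ (2 , 36) ∷ (3 , 2) ∷ (4 , 0) ∷ (5 , 38) ∷ (29 , 2) ∷ (30 , 39) ∷ (32 , 0) ∷ (32 , 37) ∷ (34 , 1) ∷ (35 , 6) ∷ (35 , 32) ∷ (35 , 39) ∷ (36 , 2) ∷ (36 , 35) ∷ []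
seed 2 6 = 0 , (0 , 2) ∷ (0 , 34) ∷ (0 , 38) ∷ (2 , 5) ∷ (3 , 0) ∷ (3 , 40) ∷ (4 , 2) ∷ (5 , 0) ∷ (6 , 38) ∷ (30 , 2) ∷ (31 , 40) ∷ (32 , 38) ∷ (33 , 0) ∷ (33 , 40) ∷ (34 , 35) ∷ (36 , 2) ∷ (36 , 6) ∷ (36 , 38) ∷ []
seed 2 7 = 0 , (0 , 2) ∷ (0 , 34) ∷ (0 , 38) ∷ (0 , 41) ∷ (2 , 5) ∷ (3 , 0) ∷ (3 , 39) ∷ (4 , 2) ∷ (5 , 0) ∷ (5 , 41) ∷ (30 , 2) ∷ (30 , 41) ∷ (33 , 0) ∷ (34 , 35) ∷ (34 , 41) ∷ (36 , 2) ∷ (36 , 6) ∷ (36 , 38) ∷ []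
seed 2 8 = 0 , (0 , 2) ∷ (0 , 42) ∷ (1 , 38) ∷ (2 , 5) ∷ (3 , 0) ∷ (3 , 40) ∷ (4 , 2) ∷ (5 , 0) ∷ (6 , 42) ∷ (30 , 2) ∷ (31 , 40) ∷ (33 , 0) ∷ (34 , 35) ∷ (34 , 36) ∷ (34 , 42) ∷ (36 , 2) ∷ (36 , 6) ∷ (36 , 39) ∷ []
seed 2 9 = 1 , (0 , 1) ∷ (0 , 39) ∷ (1 , 5) ∷ (1 , 43) ∷ (2 , 36) ∷ (2 , 40) ∷ (3 , 2) ∷ (4 , 0) ∷ (5 , 42) ∷ (29 , 2) ∷ (29 , 41) ∷ (32 , 0) ∷ (32 , 43) ∷ (34 , 1) ∷ (34 , 40) ∷ (35 , 6) ∷ (36 , 2) ∷ (36 , 37) ∷ (36 , 43) ∷ []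
seed 2 10 = 1 , (0 , 1) ∷ (0 , 39) ∷ (0 , 43) ∷ (1 , 5) ∷ (3 , 2) ∷ (4 , 0) ∷ (4 , 44) ∷ (6 , 43) ∷ (29 , 2) ∷ (32 , 0) ∷ (32 , 43) ∷ (32 , 44) ∷ (34 , 1) ∷ (34 , 40) ∷ (35 , 6) ∷ (36 , 2) ∷ (36 , 37) ∷ (36 , 43) ∷ []
seed 2 11 = 1 , (0 , 1) ∷ (0 , 39) ∷ (0 , 43) ∷ (1 , 5) ∷ (3 , 2) ∷ (3 , 45) ∷ (4 , 0) ∷ (6 , 43) ∷ (29 , 2) ∷ (31 , 45) ∷ (32 , 0) ∷ (32 , 43) ∷ (33 , 45) ∷ (34 , 1) ∷ (34 , 40) ∷ (35 , 6) ∷ (36 , 2) ∷ (36 , 43) ∷ []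
seed 2 12 = 1 , (0 , 1) ∷ (0 , 39) ∷ (0 , 43) ∷ (0 , 46) ∷ (1 , 5) ∷ (3 , 2) ∷ (3 , 44) ∷ (4 , 0) ∷ (5 , 46) ∷ (29 , 2) ∷ (30 , 46) ∷ (32 , 0) ∷ (34 , 1) ∷ (34 , 40) ∷ (34 , 46) ∷ (35 , 6) ∷ (36 , 2) ∷ (36 , 43) ∷ []
seed 3 0 = 1 , (0 , 1) ∷ (0 , 34) ∷ (1 , 5) ∷ (1 , 30) ∷ (3 , 2) ∷ (3 , 32) ∷ (4 , 0) ∷ (6 , 34) ∷ (30 , 33) ∷ (32 , 0) ∷ (33 , 34) ∷ (35 , 2) ∷ (35 , 6) ∷ (35 , 32) ∷ (36 , 4) ∷ (37 , 0) ∷ (37 , 29) ∷ (37 , 34) ∷ []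
seed 3 1 = 1 , (0 , 1) ∷ (0 , 31) ∷ (1 , 5) ∷ (1 , 31) ∷ (1 , 35) ∷ (3 , 2) ∷ (4 , 0) ∷ (4 , 33) ∷ (6 , 34) ∷ (30 , 33) ∷ (32 , 0) ∷ (33 , 35) ∷ (35 , 2) ∷ (35 , 6) ∷ (35 , 32) ∷ (36 , 4) ∷ (37 , 0) ∷ (37 , 29) ∷ (37 , 35) ∷ []
seed 3 2 = 1 , (0 , 1) ∷ (0 , 31) ∷ (0 , 34) ∷ (1 , 5) ∷ (1 , 31) ∷ (3 , 2) ∷ (3 , 36) ∷ (4 , 0) ∷ (7 , 35) ∷ (32 , 0) ∷ (33 , 35) ∷ (33 , 36) ∷ (35 , 2) ∷ (35 , 6) ∷ (35 , 32) ∷ (36 , 4) ∷ (37 , 0) ∷ (37 , 29) ∷ (37 , 35) ∷ []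
seed 3 3 = 12 , (0 , 0) ∷ (0 , 4) ∷ (0 , 37) ∷ (1 , 33) ∷ (3 , 2) ∷ (3 , 35) ∷ (5 , 2) ∷ (6 , 0) ∷ (6 , 37) ∷ (30 , 36) ∷ (31 , 2) ∷ (33 , 37) ∷ (34 , 0) ∷ (35 , 35) ∷ (37 , 2) ∷ (37 , 6) ∷ (37 , 32) ∷ (37 , 37) ∷ []
seed 3 4 = 12 , (0 , 0) ∷ (0 , 4) ∷ (0 , 34) ∷ (1 , 34) ∷ (1 , 38) ∷ (3 , 2) ∷ (4 , 36) ∷ (5 , 2) ∷ (6 , 0) ∷ (6 , 37) ∷ (30 , 36) ∷ (31 , 2) ∷ (33 , 38) ∷ (34 , 0) ∷ (35 , 35) ∷ (37 , 2) ∷ (37 , 6) ∷ (37 , 32) ∷ (37 , 38) ∷ []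
seed 3 5 = 1 , (0 , 1) ∷ (0 , 35) ∷ (1 , 5) ∷ (1 , 39) ∷ (2 , 36) ∷ (3 , 2) ∷ (4 , 0) ∷ (5 , 38) ∷ (32 , 0) ∷ (32 , 37) ∷ (35 , 2) ∷ (35 , 6) ∷ (35 , 32) ∷ (35 , 33) ∷ (35 , 39) ∷ (36 , 4) ∷ (37 , 0) ∷ (37 , 36) ∷ []
seed 3 6 = 0 , (0 , 2) ∷ (0 , 34) ∷ (0 , 38) ∷ (2 , 5) ∷ (3 , 0) ∷ (3 , 40) ∷ (4 , 2) ∷ (5 , 0) ∷ (6 , 38) ∷ (30 , 2) ∷ (31 , 40) ∷ (32 , 38) ∷ (33 , 0) ∷ (34 , 38) ∷ (35 , 1) ∷ (36 , 6) ∷ (37 , 2) ∷ (37 , 36) ∷ (37 , 40) ∷ []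
seed 3 7 = 1 , (0 , 1) ∷ (0 , 35) ∷ (0 , 41) ∷ (1 , 5) ∷ (2 , 36) ∷ (2 , 38) ∷ (3 , 2) ∷ (4 , 0) ∷ (4 , 41) ∷ (32 , 0) ∷ (33 , 40) ∷ (35 , 2) ∷ (35 , 6) ∷ (35 , 38) ∷ (36 , 4) ∷ (37 , 0) ∷ (37 , 35) ∷ (37 , 41) ∷ []
seed 3 8 = 12 , (0 , 0) ∷ (0 , 4) ∷ (0 , 38) ∷ (1 , 42) ∷ (2 , 39) ∷ (3 , 2) ∷ (5 , 2) ∷ (5 , 41) ∷ (6 , 0) ∷ (31 , 2) ∷ (32 , 40) ∷ (34 , 0) ∷ (35 , 35) ∷ (35 , 36) ∷ (35 , 42) ∷ (37 , 2) ∷ (37 , 6) ∷ (37 , 39) ∷ []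
seed 3 9 = 6 , (0 , 0) ∷ (0 , 6) ∷ (0 , 38) ∷ (0 , 42) ∷ (2 , 3) ∷ (4 , 1) ∷ (4 , 43) ∷ (6 , 42) ∷ (31 , 43) ∷ (33 , 0) ∷ (33 , 41) ∷ (35 , 3) ∷ (35 , 5) ∷ (36 , 36) ∷ (36 , 43) ∷ (37 , 0) ∷ (37 , 6) ∷ (37 , 39) ∷ []
seed 3 10 = 1 , (0 , 1) ∷ (0 , 39) ∷ (0 , 43) ∷ (1 , 5) ∷ (3 , 2) ∷ (4 , 0) ∷ (4 , 44) ∷ (6 , 43) ∷ (31 , 44) ∷ (32 , 0) ∷ (33 , 42) ∷ (35 , 2) ∷ (35 , 6) ∷ (36 , 4) ∷ (36 , 37) ∷ (36 , 44) ∷ (37 , 0) ∷ (37 , 40) ∷ []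
seed 3 11 = 1 , (0 , 1) ∷ (0 , 39) ∷ (0 , 43) ∷ (1 , 5) ∷ (3 , 2) ∷ (3 , 45) ∷ (4 , 0) ∷ (6 , 43) ∷ (31 , 45) ∷ (32 , 0) ∷ (32 , 43) ∷ (34 , 43) ∷ (35 , 2) ∷ (35 , 6) ∷ (36 , 4) ∷ (37 , 0) ∷ (37 , 41) ∷ (37 , 45) ∷ []
seed 3 12 = 12 , (0 , 0) ∷ (0 , 4) ∷ (0 , 42) ∷ (1 , 46) ∷ (2 , 39) ∷ (2 , 43) ∷ (3 , 2) ∷ (5 , 2) ∷ (5 , 45) ∷ (6 , 0) ∷ (31 , 2) ∷ (32 , 46) ∷ (34 , 0) ∷ (34 , 46) ∷ (36 , 40) ∷ (37 , 2) ∷ (37 , 6) ∷ (37 , 44) ∷ []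
seed 4 0 = 1 , (0 , 1) ∷ (0 , 34) ∷ (1 , 5) ∷ (1 , 30) ∷ (3 , 2) ∷ (3 , 32) ∷ (4 , 0) ∷ (6 , 34) ∷ (32 , 0) ∷ (34 , 34) ∷ (35 , 2) ∷ (35 , 32) ∷ (37 , 4) ∷ (37 , 29) ∷ (38 , 0) ∷ (38 , 33) ∷ []
seed 4 1 = 1 , (0 , 1) ∷ (0 , 31) ∷ (1 , 5) ∷ (1 , 31) ∷ (1 , 35) ∷ (3 , 2) ∷ (4 , 0) ∷ (4 , 33) ∷ (6 , 34) ∷ (32 , 0) ∷ (33 , 35) ∷ (35 , 2) ∷ (35 , 35) ∷ (37 , 4) ∷ (37 , 29) ∷ (38 , 0) ∷ (38 , 33) ∷ []
seed 4 2 = 1 , (0 , 1) ∷ (0 , 31) ∷ (0 , 34) ∷ (1 , 5) ∷ (1 , 31) ∷ (3 , 2) ∷ (3 , 36) ∷ (4 , 0) ∷ (7 , 35) ∷ (32 , 0) ∷ (32 , 36) ∷ (34 , 34) ∷ (35 , 2) ∷ (37 , 4) ∷ (37 , 29) ∷ (37 , 36) ∷ (38 , 0) ∷ (38 , 32) ∷ []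
seed 4 3 = 1 , (0 , 1) ∷ (0 , 35) ∷ (1 , 5) ∷ (1 , 31) ∷ (2 , 36) ∷ (3 , 2) ∷ (4 , 0) ∷ (4 , 37) ∷ (7 , 35) ∷ (32 , 0) ∷ (32 , 37) ∷ (33 , 35) ∷ (35 , 2) ∷ (35 , 35) ∷ (37 , 4) ∷ (38 , 0) ∷ (38 , 33) ∷ (38 , 37) ∷ []
seed 4 4 = 4 , (0 , 4) ∷ (0 , 33) ∷ (0 , 36) ∷ (1 , 0) ∷ (1 , 7) ∷ (1 , 33) ∷ (3 , 38) ∷ (4 , 2) ∷ (6 , 0) ∷ (7 , 37) ∷ (31 , 1) ∷ (32 , 38) ∷ (34 , 36) ∷ (35 , 0) ∷ (37 , 5) ∷ (37 , 31) ∷ (37 , 38) ∷ (38 , 2) ∷ (38 , 5) ∷ (38 , 34) ∷ []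
seed 4 5 = 1 , (0 , 1) ∷ (0 , 35) ∷ (1 , 5) ∷ (1 , 39) ∷ (2 , 36) ∷ (3 , 2) ∷ (4 , 0) ∷ (5 , 38) ∷ (31 , 38) ∷ (32 , 0) ∷ (34 , 39) ∷ (35 , 2) ∷ (36 , 37) ∷ (37 , 4) ∷ (38 , 0) ∷ (38 , 34) ∷ (38 , 39) ∷ []
seed 4 6 = 1 , (0 , 1) ∷ (0 , 35) ∷ (0 , 39) ∷ (1 , 5) ∷ (2 , 36) ∷ (3 , 2) ∷ (4 , 0) ∷ (4 , 40) ∷ (5 , 38) ∷ (31 , 38) ∷ (32 , 0) ∷ (34 , 40) ∷ (35 , 2) ∷ (36 , 37) ∷ (37 , 4) ∷ (38 , 0) ∷ (38 , 34) ∷ (38 , 40) ∷ []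
seed 4 7 = 1 , (0 , 1) ∷ (0 , 35) ∷ (0 , 41) ∷ (1 , 5) ∷ (2 , 36) ∷ (2 , 38) ∷ (3 , 2) ∷ (4 , 0) ∷ (4 , 41) ∷ (32 , 0) ∷ (34 , 40) ∷ (34 , 41) ∷ (35 , 2) ∷ (36 , 37) ∷ (37 , 4) ∷ (38 , 0) ∷ (38 , 34) ∷ (38 , 40) ∷ []
seed 4 8 = 1 , (0 , 1) ∷ (0 , 42) ∷ (1 , 5) ∷ (1 , 38) ∷ (2 , 36) ∷ (2 , 40) ∷ (3 , 2) ∷ (4 , 0) ∷ (5 , 42) ∷ (32 , 0) ∷ (33 , 42) ∷ (34 , 40) ∷ (35 , 2) ∷ (35 , 42) ∷ (36 , 37) ∷ (37 , 4) ∷ (38 , 0) ∷ (38 , 40) ∷ []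
seed 4 9 = 1 , (0 , 1) ∷ (0 , 39) ∷ (1 , 5) ∷ (1 , 43) ∷ (2 , 36) ∷ (2 , 40) ∷ (3 , 2) ∷ (4 , 0) ∷ (5 , 42) ∷ (32 , 0) ∷ (32 , 43) ∷ (35 , 2) ∷ (36 , 37) ∷ (36 , 43) ∷ (37 , 4) ∷ (38 , 0) ∷ (38 , 40) ∷ []
seed 4 10 = 1 , (0 , 1) ∷ (0 , 39) ∷ (0 , 43) ∷ (1 , 5) ∷ (3 , 2) ∷ (4 , 0) ∷ (4 , 44) ∷ (6 , 43) ∷ (32 , 0) ∷ (33 , 42) ∷ (35 , 2) ∷ (36 , 37) ∷ (36 , 38) ∷ (36 , 44) ∷ (37 , 4) ∷ (38 , 0) ∷ (38 , 41) ∷ []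
seed 4 11 = 1 , (0 , 1) ∷ (0 , 39) ∷ (0 , 43) ∷ (1 , 5) ∷ (3 , 2) ∷ (3 , 45) ∷ (4 , 0) ∷ (6 , 43) ∷ (32 , 0) ∷ (32 , 43) ∷ (34 , 44) ∷ (35 , 2) ∷ (37 , 4) ∷ (37 , 42) ∷ (38 , 0) ∷ (38 , 40) ∷ (38 , 45) ∷ []
seed 4 12 = 1 , (0 , 1) ∷ (0 , 39) ∷ (0 , 43) ∷ (0 , 46) ∷ (1 , 5) ∷ (3 , 2) ∷ (3 , 44) ∷ (4 , 0) ∷ (5 , 46) ∷ (32 , 0) ∷ (34 , 45) ∷ (35 , 2) ∷ (36 , 43) ∷ (37 , 4) ∷ (38 , 0) ∷ (38 , 40) ∷ (38 , 46) ∷ []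
seed 5 0 = 1 , (0 , 1) ∷ (0 , 34) ∷ (1 , 5) ∷ (1 , 30) ∷ (3 , 2) ∷ (3 , 32) ∷ (4 , 0) ∷ (6 , 34) ∷ (34 , 1) ∷ (34 , 34) ∷ (35 , 32) ∷ (36 , 34) ∷ (37 , 3) ∷ (37 , 29) ∷ (38 , 0) ∷ (39 , 4) ∷ (39 , 32) ∷ []
seed 5 1 = 1 , (0 , 1) ∷ (0 , 31) ∷ (1 , 5) ∷ (1 , 31) ∷ (1 , 35) ∷ (3 , 2) ∷ (4 , 0) ∷ (4 , 33) ∷ (6 , 34) ∷ (33 , 35) ∷ (34 , 1) ∷ (37 , 3) ∷ (37 , 29) ∷ (37 , 35) ∷ (38 , 0) ∷ (39 , 4) ∷ (39 , 32) ∷ []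
seed 5 2 = 1 , (0 , 1) ∷ (0 , 31) ∷ (0 , 34) ∷ (1 , 5) ∷ (1 , 31) ∷ (3 , 2) ∷ (3 , 36) ∷ (4 , 0) ∷ (7 , 35) ∷ (34 , 1) ∷ (34 , 34) ∷ (37 , 3) ∷ (37 , 29) ∷ (37 , 30) ∷ (37 , 36) ∷ (38 , 0) ∷ (39 , 4) ∷ (39 , 33) ∷ []
seed 5 3 = 1 , (0 , 1) ∷ (0 , 35) ∷ (1 , 5) ∷ (1 , 31) ∷ (2 , 36) ∷ (3 , 2) ∷ (4 , 0) ∷ (4 , 37) ∷ (7 , 35) ∷ (33 , 35) ∷ (34 , 1) ∷ (35 , 36) ∷ (37 , 3) ∷ (38 , 0) ∷ (38 , 34) ∷ (39 , 4) ∷ (39 , 32) ∷ (39 , 37) ∷ []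
seed 5 4 = 1 , (0 , 1) ∷ (0 , 34) ∷ (0 , 38) ∷ (1 , 5) ∷ (1 , 31) ∷ (2 , 36) ∷ (3 , 2) ∷ (4 , 0) ∷ (5 , 38) ∷ (34 , 1) ∷ (35 , 37) ∷ (37 , 3) ∷ (37 , 35) ∷ (38 , 0) ∷ (39 , 4) ∷ (39 , 32) ∷ (39 , 38) ∷ []
seed 5 5 = 1 , (0 , 1) ∷ (0 , 35) ∷ (1 , 5) ∷ (1 , 39) ∷ (2 , 36) ∷ (3 , 2) ∷ (4 , 0) ∷ (5 , 38) ∷ (34 , 1) ∷ (35 , 39) ∷ (36 , 37) ∷ (37 , 3) ∷ (38 , 0) ∷ (38 , 34) ∷ (39 , 4) ∷ (39 , 38) ∷ []
seed 5 6 = 1 , (0 , 1) ∷ (0 , 35) ∷ (0 , 39) ∷ (1 , 5) ∷ (2 , 36) ∷ (3 , 2) ∷ (4 , 0) ∷ (4 , 40) ∷ (5 , 38) ∷ (34 , 1) ∷ (34 , 40) ∷ (36 , 40) ∷ (37 , 3) ∷ (38 , 0) ∷ (38 , 34) ∷ (39 , 4) ∷ (39 , 38) ∷ []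
seed 5 7 = 1 , (0 , 1) ∷ (0 , 35) ∷ (0 , 41) ∷ (1 , 5) ∷ (2 , 36) ∷ (2 , 38) ∷ (3 , 2) ∷ (4 , 0) ∷ (4 , 41) ∷ (33 , 41) ∷ (34 , 1) ∷ (35 , 39) ∷ (37 , 3) ∷ (38 , 0) ∷ (38 , 34) ∷ (38 , 41) ∷ (39 , 4) ∷ (39 , 37) ∷ []
seed 5 8 = 1 , (0 , 1) ∷ (0 , 42) ∷ (1 , 5) ∷ (1 , 38) ∷ (2 , 36) ∷ (2 , 40) ∷ (3 , 2) ∷ (4 , 0) ∷ (5 , 42) ∷ (33 , 42) ∷ (34 , 1) ∷ (34 , 40) ∷ (36 , 40) ∷ (37 , 3) ∷ (38 , 0) ∷ (39 , 4) ∷ (39 , 38) ∷ (39 , 42) ∷ []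
seed 5 9 = 1 , (0 , 1) ∷ (0 , 39) ∷ (1 , 5) ∷ (1 , 43) ∷ (2 , 36) ∷ (2 , 40) ∷ (3 , 2) ∷ (4 , 0) ∷ (5 , 42) ∷ (32 , 43) ∷ (34 , 1) ∷ (35 , 42) ∷ (37 , 3) ∷ (38 , 0) ∷ (38 , 40) ∷ (39 , 4) ∷ (39 , 38) ∷ (39 , 43) ∷ []
seed 5 10 = 0 , (0 , 2) ∷ (0 , 39) ∷ (0 , 42) ∷ (1 , 39) ∷ (2 , 5) ∷ (3 , 0) ∷ (3 , 44) ∷ (4 , 2) ∷ (5 , 0) ∷ (7 , 43) ∷ (33 , 0) ∷ (34 , 42) ∷ (36 , 2) ∷ (37 , 37) ∷ (37 , 38) ∷ (37 , 44) ∷ (38 , 4) ∷ (39 , 0) ∷ (39 , 41) ∷ []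
seed 5 11 = 1 , (0 , 1) ∷ (0 , 39) ∷ (0 , 43) ∷ (1 , 5) ∷ (3 , 2) ∷ (3 , 45) ∷ (4 , 0) ∷ (6 , 43) ∷ (32 , 43) ∷ (34 , 1) ∷ (35 , 45) ∷ (37 , 3) ∷ (37 , 42) ∷ (38 , 0) ∷ (39 , 4) ∷ (39 , 39) ∷ (39 , 45) ∷ []
seed 5 12 = 1 , (0 , 1) ∷ (0 , 39) ∷ (0 , 43) ∷ (0 , 46) ∷ (1 , 5) ∷ (3 , 2) ∷ (3 , 44) ∷ (4 , 0) ∷ (5 , 46) ∷ (34 , 1) ∷ (35 , 45) ∷ (35 , 46) ∷ (37 , 3) ∷ (37 , 42) ∷ (38 , 0) ∷ (39 , 4) ∷ (39 , 39) ∷ (39 , 45) ∷ []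
seed 6 0 = 1 , (0 , 1) ∷ (0 , 34) ∷ (1 , 5) ∷ (1 , 30) ∷ (3 , 2) ∷ (3 , 32) ∷ (4 , 0) ∷ (6 , 34) ∷ (34 , 1) ∷ (34 , 34) ∷ (35 , 32) ∷ (36 , 0) ∷ (37 , 32) ∷ (40 , 1) ∷ (40 , 5) ∷ (40 , 30) ∷ (40 , 34) ∷ []
seed 6 1 = 1 , (0 , 1) ∷ (0 , 31) ∷ (1 , 5) ∷ (1 , 31) ∷ (1 , 35) ∷ (3 , 2) ∷ (4 , 0) ∷ (4 , 33) ∷ (6 , 34) ∷ (33 , 35) ∷ (34 , 1) ∷ (36 , 0) ∷ (36 , 34) ∷ (39 , 32) ∷ (40 , 1) ∷ (40 , 5) ∷ (40 , 30) ∷ (40 , 35) ∷ []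
seed 6 2 = 12 , (0 , 0) ∷ (0 , 4) ∷ (0 , 29) ∷ (0 , 33) ∷ (0 , 36) ∷ (3 , 2) ∷ (3 , 34) ∷ (5 , 2) ∷ (5 , 36) ∷ (6 , 0) ∷ (34 , 0) ∷ (34 , 36) ∷ (36 , 34) ∷ (37 , 2) ∷ (39 , 4) ∷ (39 , 29) ∷ (39 , 36) ∷ (40 , 0) ∷ (40 , 32) ∷ []
seed 6 3 = 1 , (0 , 1) ∷ (0 , 35) ∷ (1 , 5) ∷ (1 , 31) ∷ (2 , 36) ∷ (3 , 2) ∷ (4 , 0) ∷ (4 , 37) ∷ (7 , 35) ∷ (33 , 35) ∷ (34 , 1) ∷ (36 , 0) ∷ (36 , 37) ∷ (38 , 34) ∷ (40 , 1) ∷ (40 , 5) ∷ (40 , 31) ∷ (40 , 37) ∷ []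
seed 6 4 = 0 , (0 , 2) ∷ (0 , 34) ∷ (1 , 38) ∷ (2 , 5) ∷ (2 , 31) ∷ (2 , 35) ∷ (3 , 0) ∷ (4 , 2) ∷ (5 , 0) ∷ (5 , 37) ∷ (35 , 1) ∷ (36 , 37) ∷ (38 , 3) ∷ (38 , 35) ∷ (39 , 0) ∷ (40 , 4) ∷ (40 , 32) ∷ (40 , 38) ∷ []
seed 6 5 = 1 , (0 , 1) ∷ (0 , 35) ∷ (1 , 5) ∷ (1 , 39) ∷ (2 , 36) ∷ (3 , 2) ∷ (4 , 0) ∷ (5 , 38) ∷ (34 , 1) ∷ (35 , 39) ∷ (36 , 0) ∷ (36 , 37) ∷ (37 , 39) ∷ (38 , 34) ∷ (40 , 1) ∷ (40 , 5) ∷ (40 , 37) ∷ []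
seed 6 6 = 1 , (0 , 1) ∷ (0 , 35) ∷ (0 , 39) ∷ (1 , 5) ∷ (2 , 36) ∷ (3 , 2) ∷ (4 , 0) ∷ (4 , 40) ∷ (5 , 38) ∷ (34 , 1) ∷ (34 , 40) ∷ (36 , 0) ∷ (38 , 34) ∷ (38 , 40) ∷ (40 , 1) ∷ (40 , 5) ∷ (40 , 37) ∷ []
seed 6 7 = 9 , (0 , 2) ∷ (0 , 36) ∷ (0 , 40) ∷ (1 , 6) ∷ (2 , 37) ∷ (3 , 0) ∷ (4 , 41) ∷ (5 , 0) ∷ (5 , 39) ∷ (34 , 2) ∷ (34 , 41) ∷ (37 , 0) ∷ (38 , 35) ∷ (38 , 41) ∷ (40 , 2) ∷ (40 , 6) ∷ (40 , 38) ∷ []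
seed 6 8 = 0 , (0 , 2) ∷ (0 , 42) ∷ (1 , 38) ∷ (2 , 5) ∷ (3 , 0) ∷ (3 , 40) ∷ (4 , 2) ∷ (5 , 0) ∷ (6 , 42) ∷ (34 , 42) ∷ (35 , 1) ∷ (35 , 40) ∷ (37 , 40) ∷ (38 , 3) ∷ (39 , 0) ∷ (40 , 4) ∷ (40 , 38) ∷ (40 , 42) ∷ []
seed 6 9 = 1 , (0 , 1) ∷ (0 , 39) ∷ (1 , 5) ∷ (1 , 43) ∷ (2 , 36) ∷ (2 , 40) ∷ (3 , 2) ∷ (4 , 0) ∷ (5 , 42) ∷ (34 , 1) ∷ (36 , 0) ∷ (36 , 42) ∷ (38 , 40) ∷ (40 , 1) ∷ (40 , 5) ∷ (40 , 37) ∷ (40 , 43) ∷ []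
seed 6 10 = 1 , (0 , 1) ∷ (0 , 39) ∷ (0 , 43) ∷ (1 , 5) ∷ (3 , 2) ∷ (4 , 0) ∷ (4 , 44) ∷ (6 , 43) ∷ (34 , 1) ∷ (36 , 0) ∷ (36 , 44) ∷ (37 , 42) ∷ (39 , 39) ∷ (40 , 1) ∷ (40 , 5) ∷ (40 , 43) ∷ []
seed 6 11 = 1 , (0 , 1) ∷ (0 , 39) ∷ (0 , 43) ∷ (1 , 5) ∷ (3 , 2) ∷ (3 , 45) ∷ (4 , 0) ∷ (6 , 43) ∷ (34 , 1) ∷ (35 , 45) ∷ (36 , 0) ∷ (37 , 45) ∷ (39 , 39) ∷ (40 , 1) ∷ (40 , 5) ∷ (40 , 43) ∷ []
seed 6 12 = 1 , (0 , 1) ∷ (0 , 39) ∷ (0 , 43) ∷ (0 , 46) ∷ (1 , 5) ∷ (3 , 2) ∷ (3 , 44) ∷ (4 , 0) ∷ (5 , 46) ∷ (34 , 1) ∷ (34 , 46) ∷ (36 , 0) ∷ (36 , 44) ∷ (39 , 39) ∷ (39 , 46) ∷ (40 , 1) ∷ (40 , 5) ∷ (40 , 42) ∷ []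
seed 7 0 = 1 , (0 , 1) ∷ (0 , 34) ∷ (1 , 5) ∷ (1 , 30) ∷ (3 , 2) ∷ (3 , 32) ∷ (4 , 0) ∷ (6 , 34) ∷ (34 , 1) ∷ (35 , 32) ∷ (37 , 33) ∷ (38 , 0) ∷ (40 , 5) ∷ (40 , 31) ∷ (41 , 2) ∷ (41 , 5) ∷ (41 , 29) ∷ (41 , 34) ∷ []
seed 7 1 = 1 , (0 , 1) ∷ (0 , 31) ∷ (1 , 5) ∷ (1 , 31) ∷ (1 , 35) ∷ (3 , 2) ∷ (4 , 0) ∷ (4 , 33) ∷ (6 , 34) ∷ (34 , 1) ∷ (37 , 34) ∷ (38 , 0) ∷ (39 , 32) ∷ (40 , 5) ∷ (41 , 2) ∷ (41 , 5) ∷ (41 , 29) ∷ (41 , 35) ∷ []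
seed 7 2 = 1 , (0 , 1) ∷ (0 , 31) ∷ (0 , 34) ∷ (1 , 5) ∷ (1 , 31) ∷ (3 , 2) ∷ (3 , 36) ∷ (4 , 0) ∷ (7 , 35) ∷ (34 , 1) ∷ (37 , 36) ∷ (38 , 0) ∷ (38 , 34) ∷ (40 , 5) ∷ (40 , 31) ∷ (41 , 2) ∷ (41 , 5) ∷ (41 , 35) ∷ []
seed 7 3 = 1 , (0 , 1) ∷ (0 , 35) ∷ (1 , 5) ∷ (1 , 31) ∷ (2 , 36) ∷ (3 , 2) ∷ (4 , 0) ∷ (4 , 37) ∷ (7 , 35) ∷ (34 , 1) ∷ (36 , 37) ∷ (38 , 0) ∷ (38 , 37) ∷ (40 , 5) ∷ (40 , 31) ∷ (41 , 2) ∷ (41 , 5) ∷ (41 , 35) ∷ []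
seed 7 4 = 12 , (0 , 0) ∷ (0 , 4) ∷ (0 , 34) ∷ (1 , 34) ∷ (1 , 38) ∷ (3 , 2) ∷ (4 , 36) ∷ (5 , 2) ∷ (6 , 0) ∷ (6 , 37) ∷ (36 , 1) ∷ (37 , 37) ∷ (39 , 3) ∷ (39 , 35) ∷ (40 , 0) ∷ (41 , 4) ∷ (41 , 32) ∷ (41 , 38) ∷ []
seed 7 5 = 1 , (0 , 1) ∷ (0 , 35) ∷ (1 , 5) ∷ (1 , 39) ∷ (2 , 36) ∷ (3 , 2) ∷ (4 , 0) ∷ (5 , 38) ∷ (34 , 1) ∷ (35 , 39) ∷ (36 , 37) ∷ (38 , 0) ∷ (38 , 37) ∷ (40 , 5) ∷ (41 , 2) ∷ (41 , 5) ∷ (41 , 35) ∷ (41 , 39) ∷ []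
seed 7 6 = 0 , (0 , 2) ∷ (0 , 34) ∷ (0 , 38) ∷ (2 , 5) ∷ (3 , 0) ∷ (3 , 40) ∷ (4 , 2) ∷ (5 , 0) ∷ (6 , 38) ∷ (35 , 1) ∷ (35 , 40) ∷ (37 , 0) ∷ (39 , 34) ∷ (39 , 40) ∷ (41 , 1) ∷ (41 , 5) ∷ (41 , 37) ∷ []
seed 7 7 = 11 , (0 , 0) ∷ (0 , 5) ∷ (0 , 37) ∷ (1 , 3) ∷ (1 , 41) ∷ (2 , 34) ∷ (2 , 38) ∷ (4 , 1) ∷ (5 , 40) ∷ (6 , 2) ∷ (35 , 0) ∷ (37 , 40) ∷ (37 , 41) ∷ (38 , 2) ∷ (39 , 37) ∷ (40 , 4) ∷ (41 , 0) ∷ (41 , 34) ∷ (41 , 40) ∷ []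
seed 7 8 = 1 , (0 , 1) ∷ (0 , 42) ∷ (1 , 5) ∷ (1 , 38) ∷ (2 , 36) ∷ (2 , 40) ∷ (3 , 2) ∷ (4 , 0) ∷ (5 , 42) ∷ (34 , 1) ∷ (34 , 40) ∷ (37 , 42) ∷ (38 , 0) ∷ (39 , 39) ∷ (40 , 5) ∷ (41 , 2) ∷ (41 , 5) ∷ (41 , 36) ∷ (41 , 42) ∷ []
seed 7 9 = 1 , (0 , 1) ∷ (0 , 39) ∷ (1 , 5) ∷ (1 , 43) ∷ (2 , 36) ∷ (2 , 40) ∷ (3 , 2) ∷ (4 , 0) ∷ (5 , 42) ∷ (34 , 1) ∷ (37 , 42) ∷ (37 , 43) ∷ (38 , 0) ∷ (39 , 39) ∷ (40 , 5) ∷ (41 , 2) ∷ (41 , 5) ∷ (41 , 36) ∷ (41 , 42) ∷ []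
seed 7 10 = 1 , (0 , 1) ∷ (0 , 39) ∷ (0 , 43) ∷ (1 , 5) ∷ (3 , 2) ∷ (4 , 0) ∷ (4 , 44) ∷ (6 , 43) ∷ (34 , 1) ∷ (36 , 44) ∷ (37 , 42) ∷ (38 , 0) ∷ (38 , 44) ∷ (39 , 39) ∷ (40 , 5) ∷ (41 , 2) ∷ (41 , 5) ∷ (41 , 42) ∷ []
seed 7 11 = 1 , (0 , 1) ∷ (0 , 39) ∷ (0 , 43) ∷ (1 , 5) ∷ (3 , 2) ∷ (3 , 45) ∷ (4 , 0) ∷ (6 , 43) ∷ (34 , 1) ∷ (35 , 45) ∷ (38 , 0) ∷ (39 , 39) ∷ (39 , 45) ∷ (40 , 5) ∷ (41 , 2) ∷ (41 , 5) ∷ (41 , 42) ∷ []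
seed 7 12 = 1 , (0 , 1) ∷ (0 , 39) ∷ (0 , 43) ∷ (0 , 46) ∷ (1 , 5) ∷ (3 , 2) ∷ (3 , 44) ∷ (4 , 0) ∷ (5 , 46) ∷ (34 , 1) ∷ (36 , 44) ∷ (38 , 0) ∷ (39 , 39) ∷ (39 , 40) ∷ (39 , 46) ∷ (40 , 5) ∷ (41 , 2) ∷ (41 , 5) ∷ (41 , 43) ∷ []
seed 8 0 = 1 , (0 , 1) ∷ (0 , 34) ∷ (1 , 5) ∷ (1 , 30) ∷ (3 , 2) ∷ (3 , 32) ∷ (4 , 0) ∷ (6 , 34) ∷ (35 , 32) ∷ (38 , 0) ∷ (38 , 34) ∷ (40 , 3) ∷ (40 , 5) ∷ (40 , 31) ∷ (42 , 0) ∷ (42 , 6) ∷ (42 , 28) ∷ (42 , 34) ∷ []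
seed 8 1 = 1 , (0 , 1) ∷ (0 , 31) ∷ (1 , 5) ∷ (1 , 31) ∷ (1 , 35) ∷ (3 , 2) ∷ (4 , 0) ∷ (4 , 33) ∷ (6 , 34) ∷ (38 , 0) ∷ (38 , 34) ∷ (38 , 35) ∷ (40 , 3) ∷ (40 , 5) ∷ (40 , 31) ∷ (42 , 0) ∷ (42 , 6) ∷ (42 , 28) ∷ (42 , 34) ∷ []
seed 8 2 = 1 , (0 , 1) ∷ (0 , 31) ∷ (0 , 34) ∷ (1 , 5) ∷ (1 , 31) ∷ (3 , 2) ∷ (3 , 36) ∷ (4 , 0) ∷ (7 , 35) ∷ (37 , 36) ∷ (38 , 0) ∷ (38 , 34) ∷ (39 , 36) ∷ (40 , 3) ∷ (40 , 5) ∷ (40 , 31) ∷ (42 , 0) ∷ (42 , 6) ∷ (42 , 34) ∷ []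
seed 8 3 = 1 , (0 , 1) ∷ (0 , 35) ∷ (1 , 5) ∷ (1 , 31) ∷ (2 , 36) ∷ (3 , 2) ∷ (4 , 0) ∷ (4 , 37) ∷ (7 , 35) ∷ (36 , 37) ∷ (38 , 0) ∷ (40 , 3) ∷ (40 , 5) ∷ (40 , 31) ∷ (40 , 37) ∷ (42 , 0) ∷ (42 , 6) ∷ (42 , 34) ∷ []
seed 8 4 = 0 , (0 , 2) ∷ (0 , 34) ∷ (1 , 38) ∷ (2 , 5) ∷ (2 , 31) ∷ (2 , 35) ∷ (3 , 0) ∷ (4 , 2) ∷ (5 , 0) ∷ (5 , 37) ∷ (35 , 1) ∷ (36 , 38) ∷ (38 , 36) ∷ (39 , 0) ∷ (41 , 5) ∷ (41 , 31) ∷ (41 , 38) ∷ (42 , 2) ∷ (42 , 5) ∷ (42 , 34) ∷ []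
seed 8 5 = 1 , (0 , 1) ∷ (0 , 35) ∷ (1 , 5) ∷ (1 , 39) ∷ (2 , 36) ∷ (3 , 2) ∷ (4 , 0) ∷ (5 , 38) ∷ (36 , 37) ∷ (38 , 0) ∷ (38 , 38) ∷ (40 , 3) ∷ (40 , 5) ∷ (41 , 36) ∷ (42 , 0) ∷ (42 , 6) ∷ (42 , 34) ∷ (42 , 39) ∷ []
seed 8 6 = 1 , (0 , 1) ∷ (0 , 35) ∷ (0 , 39) ∷ (1 , 5) ∷ (2 , 36) ∷ (3 , 2) ∷ (4 , 0) ∷ (4 , 40) ∷ (5 , 38) ∷ (38 , 0) ∷ (38 , 39) ∷ (40 , 3) ∷ (40 , 5) ∷ (40 , 37) ∷ (42 , 0) ∷ (42 , 6) ∷ (42 , 34) ∷ (42 , 40) ∷ []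
seed 8 7 = 1 , (0 , 1) ∷ (0 , 35) ∷ (0 , 41) ∷ (1 , 5) ∷ (2 , 36) ∷ (2 , 38) ∷ (3 , 2) ∷ (4 , 0) ∷ (4 , 41) ∷ (38 , 0) ∷ (38 , 41) ∷ (39 , 39) ∷ (40 , 3) ∷ (40 , 5) ∷ (41 , 36) ∷ (42 , 0) ∷ (42 , 6) ∷ (42 , 40) ∷ []
seed 8 8 = 0 , (0 , 2) ∷ (0 , 42) ∷ (1 , 38) ∷ (2 , 5) ∷ (3 , 0) ∷ (3 , 40) ∷ (4 , 2) ∷ (5 , 0) ∷ (6 , 42) ∷ (35 , 1) ∷ (35 , 40) ∷ (38 , 42) ∷ (39 , 0) ∷ (40 , 39) ∷ (41 , 5) ∷ (42 , 2) ∷ (42 , 5) ∷ (42 , 36) ∷ (42 , 42) ∷ []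
seed 8 9 = 1 , (0 , 1) ∷ (0 , 39) ∷ (1 , 5) ∷ (1 , 43) ∷ (2 , 36) ∷ (2 , 40) ∷ (3 , 2) ∷ (4 , 0) ∷ (5 , 42) ∷ (36 , 43) ∷ (38 , 0) ∷ (38 , 41) ∷ (40 , 3) ∷ (40 , 5) ∷ (41 , 36) ∷ (41 , 43) ∷ (42 , 0) ∷ (42 , 6) ∷ (42 , 39) ∷ []
seed 8 10 = 1 , (0 , 1) ∷ (0 , 39) ∷ (0 , 43) ∷ (1 , 5) ∷ (3 , 2) ∷ (4 , 0) ∷ (4 , 44) ∷ (6 , 43) ∷ (36 , 44) ∷ (37 , 42) ∷ (38 , 0) ∷ (39 , 42) ∷ (40 , 3) ∷ (40 , 5) ∷ (42 , 0) ∷ (42 , 6) ∷ (42 , 40) ∷ (42 , 44) ∷ []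
seed 8 11 = 1 , (0 , 1) ∷ (0 , 39) ∷ (0 , 43) ∷ (1 , 5) ∷ (3 , 2) ∷ (3 , 45) ∷ (4 , 0) ∷ (6 , 43) ∷ (35 , 45) ∷ (38 , 0) ∷ (38 , 44) ∷ (40 , 3) ∷ (40 , 5) ∷ (41 , 42) ∷ (42 , 0) ∷ (42 , 6) ∷ (42 , 40) ∷ (42 , 45) ∷ []
seed 8 12 = 12 , (0 , 0) ∷ (0 , 4) ∷ (0 , 42) ∷ (1 , 46) ∷ (2 , 39) ∷ (2 , 43) ∷ (3 , 2) ∷ (5 , 2) ∷ (5 , 45) ∷ (6 , 0) ∷ (36 , 1) ∷ (36 , 46) ∷ (38 , 0) ∷ (38 , 44) ∷ (41 , 39) ∷ (41 , 46) ∷ (42 , 1) ∷ (42 , 5) ∷ (42 , 42) ∷ []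
seed 9 0 = 1 , (0 , 1) ∷ (0 , 34) ∷ (1 , 5) ∷ (1 , 30) ∷ (3 , 2) ∷ (3 , 32) ∷ (4 , 0) ∷ (6 , 34) ∷ (38 , 0) ∷ (38 , 34) ∷ (40 , 2) ∷ (40 , 34) ∷ (42 , 28) ∷ (43 , 0) ∷ (43 , 3) ∷ (43 , 7) ∷ (43 , 32) ∷ []
seed 9 1 = 1 , (0 , 1) ∷ (0 , 31) ∷ (1 , 5) ∷ (1 , 31) ∷ (1 , 35) ∷ (3 , 2) ∷ (4 , 0) ∷ (4 , 33) ∷ (6 , 34) ∷ (37 , 35) ∷ (38 , 0) ∷ (39 , 33) ∷ (40 , 2) ∷ (42 , 28) ∷ (42 , 35) ∷ (43 , 0) ∷ (43 , 3) ∷ (43 , 7) ∷ (43 , 31) ∷ []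
seed 9 2 = 1 , (0 , 1) ∷ (0 , 31) ∷ (0 , 34) ∷ (1 , 5) ∷ (1 , 31) ∷ (3 , 2) ∷ (3 , 36) ∷ (4 , 0) ∷ (7 , 35) ∷ (37 , 36) ∷ (38 , 0) ∷ (38 , 34) ∷ (40 , 2) ∷ (40 , 34) ∷ (43 , 0) ∷ (43 , 3) ∷ (43 , 7) ∷ (43 , 32) ∷ (43 , 36) ∷ []
seed 9 3 = 12 , (0 , 0) ∷ (0 , 4) ∷ (0 , 37) ∷ (1 , 33) ∷ (3 , 2) ∷ (3 , 35) ∷ (5 , 2) ∷ (6 , 0) ∷ (6 , 37) ∷ (36 , 1) ∷ (38 , 37) ∷ (40 , 0) ∷ (40 , 37) ∷ (42 , 5) ∷ (42 , 31) ∷ (43 , 2) ∷ (43 , 5) ∷ (43 , 35) ∷ []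
seed 9 4 = 12 , (0 , 0) ∷ (0 , 4) ∷ (0 , 34) ∷ (1 , 34) ∷ (1 , 38) ∷ (3 , 2) ∷ (4 , 36) ∷ (5 , 2) ∷ (6 , 0) ∷ (6 , 37) ∷ (36 , 1) ∷ (37 , 38) ∷ (39 , 36) ∷ (40 , 0) ∷ (42 , 5) ∷ (42 , 31) ∷ (42 , 38) ∷ (43 , 2) ∷ (43 , 5) ∷ (43 , 34) ∷ []
seed 9 5 = 1 , (0 , 1) ∷ (0 , 35) ∷ (1 , 5) ∷ (1 , 39) ∷ (2 , 36) ∷ (3 , 2) ∷ (4 , 0) ∷ (5 , 38) ∷ (36 , 37) ∷ (38 , 0) ∷ (39 , 39) ∷ (40 , 2) ∷ (41 , 36) ∷ (43 , 0) ∷ (43 , 3) ∷ (43 , 7) ∷ (43 , 33) ∷ (43 , 39) ∷ []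
seed 9 6 = 0 , (0 , 2) ∷ (0 , 34) ∷ (0 , 38) ∷ (2 , 5) ∷ (3 , 0) ∷ (3 , 40) ∷ (4 , 2) ∷ (5 , 0) ∷ (6 , 38) ∷ (39 , 0) ∷ (39 , 39) ∷ (41 , 3) ∷ (41 , 5) ∷ (41 , 37) ∷ (43 , 0) ∷ (43 , 6) ∷ (43 , 34) ∷ (43 , 40) ∷ []
seed 9 7 = 10 , (0 , 0) ∷ (0 , 6) ∷ (0 , 37) ∷ (1 , 37) ∷ (1 , 41) ∷ (2 , 3) ∷ (4 , 0) ∷ (4 , 39) ∷ (6 , 40) ∷ (7 , 2) ∷ (37 , 41) ∷ (38 , 1) ∷ (39 , 39) ∷ (41 , 3) ∷ (42 , 0) ∷ (42 , 34) ∷ (42 , 41) ∷ (43 , 4) ∷ (43 , 37) ∷ []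
seed 9 8 = 1 , (0 , 1) ∷ (0 , 42) ∷ (1 , 5) ∷ (1 , 38) ∷ (2 , 36) ∷ (2 , 40) ∷ (3 , 2) ∷ (4 , 0) ∷ (5 , 42) ∷ (37 , 42) ∷ (38 , 0) ∷ (40 , 2) ∷ (41 , 36) ∷ (41 , 42) ∷ (43 , 0) ∷ (43 , 3) ∷ (43 , 7) ∷ (43 , 39) ∷ []
seed 9 9 = 11 , (0 , 0) ∷ (0 , 5) ∷ (0 , 37) ∷ (0 , 41) ∷ (1 , 3) ∷ (3 , 43) ∷ (4 , 1) ∷ (6 , 2) ∷ (6 , 41) ∷ (37 , 1) ∷ (39 , 0) ∷ (39 , 42) ∷ (41 , 40) ∷ (43 , 1) ∷ (43 , 5) ∷ (43 , 37) ∷ (43 , 43) ∷ []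
seed 9 10 = 9 , (0 , 2) ∷ (0 , 40) ∷ (1 , 6) ∷ (1 , 44) ∷ (2 , 37) ∷ (2 , 41) ∷ (3 , 0) ∷ (5 , 0) ∷ (5 , 43) ∷ (37 , 0) ∷ (38 , 42) ∷ (40 , 2) ∷ (41 , 37) ∷ (41 , 38) ∷ (41 , 44) ∷ (42 , 4) ∷ (43 , 0) ∷ (43 , 41) ∷ []
seed 9 11 = 1 , (0 , 1) ∷ (0 , 39) ∷ (0 , 43) ∷ (1 , 5) ∷ (3 , 2) ∷ (3 , 45) ∷ (4 , 0) ∷ (6 , 43) ∷ (38 , 0) ∷ (39 , 44) ∷ (40 , 2) ∷ (41 , 42) ∷ (43 , 0) ∷ (43 , 3) ∷ (43 , 7) ∷ (43 , 39) ∷ (43 , 45) ∷ []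
seed 9 12 = 1 , (0 , 1) ∷ (0 , 39) ∷ (0 , 43) ∷ (0 , 46) ∷ (1 , 5) ∷ (3 , 2) ∷ (3 , 44) ∷ (4 , 0) ∷ (5 , 46) ∷ (38 , 0) ∷ (39 , 46) ∷ (40 , 2) ∷ (40 , 44) ∷ (42 , 41) ∷ (43 , 0) ∷ (43 , 3) ∷ (43 , 7) ∷ (43 , 45) ∷ []
seed 10 0 = 1 , (0 , 1) ∷ (0 , 34) ∷ (1 , 5) ∷ (1 , 30) ∷ (3 , 2) ∷ (3 , 32) ∷ (4 , 0) ∷ (6 , 34) ∷ (38 , 34) ∷ (39 , 0) ∷ (42 , 2) ∷ (42 , 28) ∷ (42 , 34) ∷ (43 , 7) ∷ (44 , 0) ∷ (44 , 4) ∷ (44 , 31) ∷ []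
seed 10 1 = 12 , (0 , 0) ∷ (0 , 4) ∷ (0 , 29) ∷ (0 , 33) ∷ (3 , 2) ∷ (3 , 35) ∷ (5 , 2) ∷ (6 , 0) ∷ (6 , 33) ∷ (40 , 0) ∷ (40 , 34) ∷ (40 , 35) ∷ (42 , 3) ∷ (42 , 5) ∷ (42 , 31) ∷ (44 , 0) ∷ (44 , 6) ∷ (44 , 28) ∷ (44 , 34) ∷ []
seed 10 2 = 9 , (0 , 2) ∷ (0 , 32) ∷ (1 , 6) ∷ (1 , 32) ∷ (1 , 36) ∷ (3 , 0) ∷ (4 , 34) ∷ (5 , 0) ∷ (6 , 35) ∷ (39 , 1) ∷ (39 , 34) ∷ (42 , 3) ∷ (42 , 29) ∷ (42 , 30) ∷ (42 , 36) ∷ (43 , 0) ∷ (44 , 4) ∷ (44 , 33) ∷ []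
seed 10 3 = 1 , (0 , 1) ∷ (0 , 35) ∷ (1 , 5) ∷ (1 , 31) ∷ (2 , 36) ∷ (3 , 2) ∷ (4 , 0) ∷ (4 , 37) ∷ (7 , 35) ∷ (39 , 0) ∷ (40 , 36) ∷ (42 , 2) ∷ (42 , 34) ∷ (43 , 7) ∷ (44 , 0) ∷ (44 , 4) ∷ (44 , 31) ∷ (44 , 37) ∷ []
seed 10 4 = 10 , (0 , 0) ∷ (0 , 6) ∷ (0 , 32) ∷ (0 , 36) ∷ (2 , 3) ∷ (3 , 38) ∷ (4 , 0) ∷ (6 , 36) ∷ (7 , 2) ∷ (38 , 1) ∷ (40 , 0) ∷ (40 , 37) ∷ (40 , 38) ∷ (42 , 34) ∷ (44 , 1) ∷ (44 , 5) ∷ (44 , 31) ∷ (44 , 37) ∷ []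
seed 10 5 = 8 , (0 , 3) ∷ (0 , 35) ∷ (1 , 39) ∷ (2 , 0) ∷ (2 , 6) ∷ (2 , 32) ∷ (2 , 36) ∷ (5 , 38) ∷ (6 , 0) ∷ (37 , 38) ∷ (38 , 0) ∷ (40 , 39) ∷ (41 , 2) ∷ (42 , 37) ∷ (43 , 4) ∷ (44 , 0) ∷ (44 , 34) ∷ (44 , 39) ∷ []
seed 10 6 = 0 , (0 , 2) ∷ (0 , 34) ∷ (0 , 38) ∷ (2 , 5) ∷ (3 , 0) ∷ (3 , 40) ∷ (4 , 2) ∷ (5 , 0) ∷ (6 , 38) ∷ (39 , 0) ∷ (40 , 39) ∷ (40 , 40) ∷ (41 , 2) ∷ (42 , 36) ∷ (44 , 0) ∷ (44 , 3) ∷ (44 , 7) ∷ (44 , 33) ∷ (44 , 39) ∷ []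
seed 10 7 = 10 , (0 , 0) ∷ (0 , 6) ∷ (0 , 37) ∷ (1 , 37) ∷ (1 , 41) ∷ (2 , 3) ∷ (4 , 0) ∷ (4 , 39) ∷ (6 , 40) ∷ (7 , 2) ∷ (38 , 1) ∷ (39 , 39) ∷ (40 , 0) ∷ (42 , 34) ∷ (42 , 35) ∷ (42 , 41) ∷ (44 , 1) ∷ (44 , 5) ∷ (44 , 38) ∷ []
seed 10 8 = 0 , (0 , 2) ∷ (0 , 42) ∷ (1 , 38) ∷ (2 , 5) ∷ (3 , 0) ∷ (3 , 40) ∷ (4 , 2) ∷ (5 , 0) ∷ (6 , 42) ∷ (38 , 42) ∷ (39 , 0) ∷ (41 , 2) ∷ (42 , 36) ∷ (42 , 42) ∷ (44 , 0) ∷ (44 , 3) ∷ (44 , 7) ∷ (44 , 39) ∷ []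
seed 10 9 = 11 , (0 , 0) ∷ (0 , 5) ∷ (0 , 37) ∷ (0 , 41) ∷ (1 , 3) ∷ (3 , 43) ∷ (4 , 1) ∷ (6 , 2) ∷ (6 , 41) ∷ (37 , 1) ∷ (40 , 42) ∷ (40 , 43) ∷ (41 , 0) ∷ (42 , 39) ∷ (43 , 5) ∷ (44 , 2) ∷ (44 , 5) ∷ (44 , 36) ∷ (44 , 42) ∷ []
seed 10 10 = 8 , (0 , 3) ∷ (0 , 40) ∷ (1 , 40) ∷ (1 , 44) ∷ (2 , 0) ∷ (2 , 6) ∷ (4 , 42) ∷ (6 , 0) ∷ (6 , 43) ∷ (38 , 0) ∷ (39 , 42) ∷ (41 , 2) ∷ (42 , 37) ∷ (42 , 38) ∷ (42 , 44) ∷ (43 , 4) ∷ (44 , 0) ∷ (44 , 41) ∷ []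
seed 10 11 = 1 , (0 , 1) ∷ (0 , 39) ∷ (0 , 43) ∷ (1 , 5) ∷ (3 , 2) ∷ (3 , 45) ∷ (4 , 0) ∷ (6 , 43) ∷ (39 , 0) ∷ (40 , 44) ∷ (40 , 45) ∷ (42 , 2) ∷ (42 , 41) ∷ (43 , 7) ∷ (44 , 0) ∷ (44 , 4) ∷ (44 , 38) ∷ (44 , 44) ∷ []
seed 10 12 = 11 , (0 , 0) ∷ (0 , 5) ∷ (0 , 42) ∷ (1 , 3) ∷ (1 , 42) ∷ (1 , 46) ∷ (4 , 1) ∷ (4 , 44) ∷ (6 , 2) ∷ (6 , 45) ∷ (37 , 1) ∷ (39 , 44) ∷ (41 , 0) ∷ (42 , 39) ∷ (42 , 40) ∷ (42 , 46) ∷ (43 , 5) ∷ (44 , 2) ∷ (44 , 5) ∷ (44 , 43) ∷ []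
seed 11 0 = 1 , (0 , 1) ∷ (0 , 34) ∷ (1 , 5) ∷ (1 , 30) ∷ (3 , 2) ∷ (3 , 32) ∷ (4 , 0) ∷ (6 , 34) ∷ (38 , 34) ∷ (40 , 1) ∷ (41 , 33) ∷ (43 , 3) ∷ (43 , 7) ∷ (44 , 0) ∷ (44 , 31) ∷ (45 , 4) ∷ (45 , 29) ∷ (45 , 34) ∷ []
seed 11 1 = 12 , (0 , 0) ∷ (0 , 4) ∷ (0 , 29) ∷ (0 , 33) ∷ (3 , 2) ∷ (3 , 35) ∷ (5 , 2) ∷ (6 , 0) ∷ (6 , 33) ∷ (39 , 35) ∷ (40 , 0) ∷ (41 , 33) ∷ (42 , 2) ∷ (44 , 28) ∷ (44 , 35) ∷ (45 , 0) ∷ (45 , 3) ∷ (45 , 7) ∷ (45 , 31) ∷ []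
seed 11 2 = 1 , (0 , 1) ∷ (0 , 31) ∷ (0 , 34) ∷ (1 , 5) ∷ (1 , 31) ∷ (3 , 2) ∷ (3 , 36) ∷ (4 , 0) ∷ (7 , 35) ∷ (38 , 34) ∷ (40 , 1) ∷ (41 , 36) ∷ (43 , 3) ∷ (43 , 7) ∷ (43 , 33) ∷ (44 , 0) ∷ (45 , 4) ∷ (45 , 30) ∷ (45 , 36) ∷ []
seed 11 3 = 1 , (0 , 1) ∷ (0 , 35) ∷ (1 , 5) ∷ (1 , 31) ∷ (2 , 36) ∷ (3 , 2) ∷ (4 , 0) ∷ (4 , 37) ∷ (7 , 35) ∷ (40 , 1) ∷ (41 , 36) ∷ (41 , 37) ∷ (43 , 3) ∷ (43 , 7) ∷ (43 , 33) ∷ (44 , 0) ∷ (45 , 4) ∷ (45 , 30) ∷ (45 , 36) ∷ []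
seed 11 4 = 10 , (0 , 0) ∷ (0 , 6) ∷ (0 , 32) ∷ (0 , 36) ∷ (2 , 3) ∷ (3 , 38) ∷ (4 , 0) ∷ (6 , 36) ∷ (7 , 2) ∷ (38 , 1) ∷ (39 , 38) ∷ (41 , 36) ∷ (42 , 0) ∷ (44 , 5) ∷ (44 , 31) ∷ (44 , 38) ∷ (45 , 2) ∷ (45 , 5) ∷ (45 , 34) ∷ []
seed 11 5 = 1 , (0 , 1) ∷ (0 , 35) ∷ (1 , 5) ∷ (1 , 39) ∷ (2 , 36) ∷ (3 , 2) ∷ (4 , 0) ∷ (5 , 38) ∷ (39 , 39) ∷ (40 , 1) ∷ (43 , 3) ∷ (43 , 7) ∷ (43 , 33) ∷ (43 , 39) ∷ (44 , 0) ∷ (45 , 4) ∷ (45 , 36) ∷ []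
seed 11 6 = 10 , (0 , 0) ∷ (0 , 6) ∷ (0 , 40) ∷ (1 , 36) ∷ (2 , 3) ∷ (3 , 38) ∷ (4 , 0) ∷ (6 , 40) ∷ (7 , 2) ∷ (38 , 1) ∷ (38 , 40) ∷ (41 , 39) ∷ (42 , 0) ∷ (44 , 5) ∷ (44 , 37) ∷ (45 , 2) ∷ (45 , 5) ∷ (45 , 35) ∷ (45 , 40) ∷ []
seed 11 7 = 8 , (0 , 3) ∷ (0 , 35) ∷ (0 , 39) ∷ (2 , 0) ∷ (2 , 6) ∷ (3 , 41) ∷ (6 , 0) ∷ (6 , 39) ∷ (39 , 41) ∷ (40 , 1) ∷ (41 , 39) ∷ (43 , 3) ∷ (44 , 0) ∷ (44 , 34) ∷ (44 , 41) ∷ (45 , 4) ∷ (45 , 37) ∷ []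
seed 11 8 = 1 , (0 , 1) ∷ (0 , 42) ∷ (1 , 5) ∷ (1 , 38) ∷ (2 , 36) ∷ (2 , 40) ∷ (3 , 2) ∷ (4 , 0) ∷ (5 , 42) ∷ (40 , 1) ∷ (41 , 41) ∷ (43 , 3) ∷ (43 , 7) ∷ (43 , 39) ∷ (44 , 0) ∷ (45 , 4) ∷ (45 , 36) ∷ (45 , 42) ∷ []
seed 11 9 = 1 , (0 , 1) ∷ (0 , 39) ∷ (1 , 5) ∷ (1 , 43) ∷ (2 , 36) ∷ (2 , 40) ∷ (3 , 2) ∷ (4 , 0) ∷ (5 , 42) ∷ (40 , 1) ∷ (41 , 43) ∷ (42 , 41) ∷ (43 , 3) ∷ (43 , 7) ∷ (44 , 0) ∷ (44 , 38) ∷ (45 , 4) ∷ (45 , 42) ∷ []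
seed 11 10 = 1 , (0 , 1) ∷ (0 , 39) ∷ (0 , 43) ∷ (1 , 5) ∷ (3 , 2) ∷ (4 , 0) ∷ (4 , 44) ∷ (6 , 43) ∷ (40 , 1) ∷ (40 , 44) ∷ (42 , 44) ∷ (43 , 3) ∷ (43 , 7) ∷ (44 , 0) ∷ (44 , 38) ∷ (45 , 4) ∷ (45 , 42) ∷ []
seed 11 11 = 1 , (0 , 1) ∷ (0 , 39) ∷ (0 , 43) ∷ (1 , 5) ∷ (3 , 2) ∷ (3 , 45) ∷ (4 , 0) ∷ (6 , 43) ∷ (39 , 45) ∷ (40 , 1) ∷ (41 , 43) ∷ (43 , 3) ∷ (43 , 7) ∷ (44 , 0) ∷ (44 , 38) ∷ (44 , 45) ∷ (45 , 4) ∷ (45 , 41) ∷ []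
seed 11 12 = 1 , (0 , 1) ∷ (0 , 39) ∷ (0 , 43) ∷ (0 , 46) ∷ (1 , 5) ∷ (3 , 2) ∷ (3 , 44) ∷ (4 , 0) ∷ (5 , 46) ∷ (39 , 46) ∷ (40 , 1) ∷ (40 , 44) ∷ (42 , 44) ∷ (43 , 3) ∷ (43 , 7) ∷ (44 , 0) ∷ (45 , 4) ∷ (45 , 42) ∷ (45 , 46) ∷ []
seed 12 0 = 1 , (0 , 1) ∷ (0 , 34) ∷ (1 , 5) ∷ (1 , 30) ∷ (3 , 2) ∷ (3 , 32) ∷ (4 , 0) ∷ (6 , 34) ∷ (40 , 1) ∷ (42 , 2) ∷ (42 , 33) ∷ (44 , 31) ∷ (45 , 0) ∷ (45 , 4) ∷ (46 , 4) ∷ (46 , 28) ∷ (46 , 34) ∷ []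
seed 12 1 = 1 , (0 , 1) ∷ (0 , 31) ∷ (1 , 5) ∷ (1 , 31) ∷ (1 , 35) ∷ (3 , 2) ∷ (4 , 0) ∷ (4 , 33) ∷ (6 , 34) ∷ (40 , 1) ∷ (42 , 2) ∷ (42 , 35) ∷ (43 , 33) ∷ (45 , 0) ∷ (45 , 4) ∷ (45 , 30) ∷ (46 , 4) ∷ (46 , 34) ∷ []
seed 12 2 = 1 , (0 , 1) ∷ (0 , 31) ∷ (0 , 34) ∷ (1 , 5) ∷ (1 , 31) ∷ (3 , 2) ∷ (3 , 36) ∷ (4 , 0) ∷ (7 , 35) ∷ (40 , 1) ∷ (41 , 36) ∷ (42 , 2) ∷ (43 , 36) ∷ (45 , 0) ∷ (45 , 4) ∷ (45 , 30) ∷ (46 , 4) ∷ (46 , 34) ∷ []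
seed 12 3 = 1 , (0 , 1) ∷ (0 , 35) ∷ (1 , 5) ∷ (1 , 31) ∷ (2 , 36) ∷ (3 , 2) ∷ (4 , 0) ∷ (4 , 37) ∷ (7 , 35) ∷ (40 , 1) ∷ (40 , 37) ∷ (42 , 2) ∷ (42 , 35) ∷ (45 , 0) ∷ (45 , 4) ∷ (45 , 30) ∷ (45 , 37) ∷ (46 , 4) ∷ (46 , 33) ∷ []
seed 12 4 = 10 , (0 , 0) ∷ (0 , 6) ∷ (0 , 32) ∷ (0 , 36) ∷ (2 , 3) ∷ (3 , 38) ∷ (4 , 0) ∷ (6 , 36) ∷ (7 , 2) ∷ (41 , 36) ∷ (42 , 0) ∷ (44 , 3) ∷ (44 , 5) ∷ (44 , 31) ∷ (44 , 32) ∷ (44 , 38) ∷ (46 , 0) ∷ (46 , 6) ∷ (46 , 35) ∷ []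
seed 12 5 = 1 , (0 , 1) ∷ (0 , 35) ∷ (1 , 5) ∷ (1 , 39) ∷ (2 , 36) ∷ (3 , 2) ∷ (4 , 0) ∷ (5 , 38) ∷ (39 , 39) ∷ (40 , 1) ∷ (42 , 2) ∷ (42 , 38) ∷ (45 , 0) ∷ (45 , 4) ∷ (45 , 36) ∷ (46 , 4) ∷ (46 , 34) ∷ (46 , 39) ∷ []
seed 12 6 = 0 , (0 , 2) ∷ (0 , 34) ∷ (0 , 38) ∷ (2 , 5) ∷ (3 , 0) ∷ (3 , 40) ∷ (4 , 2) ∷ (5 , 0) ∷ (6 , 38) ∷ (41 , 1) ∷ (41 , 38) ∷ (44 , 3) ∷ (44 , 7) ∷ (44 , 33) ∷ (44 , 34) ∷ (44 , 40) ∷ (45 , 0) ∷ (46 , 4) ∷ (46 , 37) ∷ []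
seed 12 7 = 1 , (0 , 1) ∷ (0 , 35) ∷ (0 , 41) ∷ (1 , 5) ∷ (2 , 36) ∷ (2 , 38) ∷ (3 , 2) ∷ (4 , 0) ∷ (4 , 41) ∷ (39 , 39) ∷ (40 , 1) ∷ (42 , 2) ∷ (42 , 41) ∷ (44 , 38) ∷ (45 , 0) ∷ (45 , 4) ∷ (46 , 4) ∷ (46 , 35) ∷ (46 , 41) ∷ []
seed 12 8 = 1 , (0 , 1) ∷ (0 , 42) ∷ (1 , 5) ∷ (1 , 38) ∷ (2 , 36) ∷ (2 , 40) ∷ (3 , 2) ∷ (4 , 0) ∷ (5 , 42) ∷ (40 , 1) ∷ (42 , 2) ∷ (42 , 41) ∷ (42 , 42) ∷ (44 , 38) ∷ (45 , 0) ∷ (45 , 4) ∷ (46 , 4) ∷ (46 , 35) ∷ (46 , 41) ∷ []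
seed 12 9 = 1 , (0 , 1) ∷ (0 , 39) ∷ (1 , 5) ∷ (1 , 43) ∷ (2 , 36) ∷ (2 , 40) ∷ (3 , 2) ∷ (4 , 0) ∷ (5 , 42) ∷ (40 , 1) ∷ (41 , 43) ∷ (42 , 2) ∷ (42 , 41) ∷ (43 , 43) ∷ (44 , 38) ∷ (45 , 0) ∷ (45 , 4) ∷ (46 , 4) ∷ (46 , 41) ∷ []
seed 12 10 = 1 , (0 , 1) ∷ (0 , 39) ∷ (0 , 43) ∷ (1 , 5) ∷ (3 , 2) ∷ (4 , 0) ∷ (4 , 44) ∷ (6 , 43) ∷ (40 , 1) ∷ (40 , 44) ∷ (42 , 2) ∷ (44 , 38) ∷ (44 , 44) ∷ (45 , 0) ∷ (45 , 4) ∷ (46 , 4) ∷ (46 , 41) ∷ []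
seed 12 11 = 1 , (0 , 1) ∷ (0 , 39) ∷ (0 , 43) ∷ (1 , 5) ∷ (3 , 2) ∷ (3 , 45) ∷ (4 , 0) ∷ (6 , 43) ∷ (40 , 1) ∷ (41 , 43) ∷ (42 , 2) ∷ (44 , 38) ∷ (44 , 39) ∷ (44 , 45) ∷ (45 , 0) ∷ (45 , 4) ∷ (46 , 4) ∷ (46 , 42) ∷ []
seed 12 12 = 1 , (0 , 1) ∷ (0 , 39) ∷ (0 , 43) ∷ (0 , 46) ∷ (1 , 5) ∷ (3 , 2) ∷ (3 , 44) ∷ (4 , 0) ∷ (5 , 46) ∷ (40 , 1) ∷ (40 , 44) ∷ (42 , 2) ∷ (42 , 45) ∷ (45 , 0) ∷ (45 , 4) ∷ (45 , 43) ∷ (46 , 4) ∷ (46 , 41) ∷ (46 , 46) ∷ []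
seed _ _ = 0 , []

seedExtendableᵇ : ℕ → ℕ → Bool
seedExtendableᵇ r s =
  extendableᵇ (deficit (35 + r) (35 + s)) (35 + r) (35 + s) (seedPattern (35 + r) (35 + s) (seed r s))

-- Stated with ≡ true rather than T: a term of type T (…) makes Agda normalise the check several times slower.
seeds-valid : allᵇ (λ r → allᵇ (seedExtendableᵇ r) (downFrom 13)) (downFrom 13) ≡ true
seeds-valid = refl

-- r and s are explicit: solving them by unification would make Agda unfold the check symbolically.
allᵇ²-sound : ∀ (p : ℕ → ℕ → Bool) k → allᵇ (λ r → allᵇ (p r) (downFrom k)) (downFrom k) ≡ true →
  ∀ r s → r < k → s < k → p r s ≡ true
allᵇ²-sound p k ok r s r<k s<k = allᵇ-sound (p r) (downFrom k)
  (allᵇ-sound (λ r → allᵇ (p r) (downFrom k)) (downFrom k) ok (∈-downFrom⁺ r<k)) (∈-downFrom⁺ s<k)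

seed-extendable : ∀ r s → r < 13 → s < 13 →
  Extendable (deficit (35 + r) (35 + s)) (35 + r) (35 + s) (seedPattern (35 + r) (35 + s) (seed r s))
seed-extendable r s r<13 s<13 =
  extendableᵇ-sound (23≤35+ r) (23≤35+ s) (allᵇ²-sound seedExtendableᵇ 13 seeds-valid r s r<13 s<13)
  where
  23≤35+ : ∀ k → 23 ≤ 35 + k
  23≤35+ k = ≤-trans (m≤m+n 23 12) (m≤m+n 35 k)

seed+multiple : ∀ {m} → 35 ≤ m → 35 + (m ∸ 35) % 13 + (m ∸ 35) / 13 * 13 ≡ m
seed+multiple {m} 35≤m = begin
  35 + (m ∸ 35) % 13 + (m ∸ 35) / 13 * 13    ≡⟨ +-assoc 35 ((m ∸ 35) % 13) ((m ∸ 35) / 13 * 13) ⟩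
  35 + ((m ∸ 35) % 13 + (m ∸ 35) / 13 * 13)  ≡⟨ cong (35 +_) (m≡m%n+[m/n]*n (m ∸ 35) 13) ⟨
  35 + (m ∸ 35)                              ≡⟨ m+[n∸m]≡n 35≤m ⟩
  m                                          ∎
  where open ≡-Reasoning

large-extendable : ∀ {m n} → 35 ≤ m → 35 ≤ n → ∃ (Extendable (deficit m n) m n)
large-extendable {m} {n} 35≤m 35≤n =
  subst₂ (λ m n → ∃ (Extendable (deficit m n) m n)) (seed+multiple 35≤m) (seed+multiple 35≤n)
    (subst (λ δ → ∃ (Extendable δ (35 + r + a * 13) (35 + s + b * 13))) (sym (deficit-+*13 (35 + r) (35 + s) a b))
      (extend a b (seed-extendable r s (m%n<n (m ∸ 35) 13) (m%n<n (n ∸ 35) 13))))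
  where
  r = (m ∸ 35) % 13
  s = (n ∸ 35) % 13
  a = (m ∸ 35) / 13
  b = (n ∸ 35) / 13

mainTheorem11 : Σ ℕ λ N → (m n : ℕ) → m ≥ N → n ≥ N →
    (((((m + 4) % 13) , ((n + 4) % 13)) ∈ Φ) → γ≤ 3 1 m n (base m n ∸ 5)) ×
    ((¬ ((((m + 4) % 13) , ((n + 4) % 13)) ∈ Φ)) → γ≤ 3 1 m n (base m n ∸ 4))
mainTheorem11 = 35 , λ m n 35≤m 35≤n →
  let _ , E = large-extendable 35≤m 35≤n
      γ≤base∸ : ∀ {δ} → deficit m n ≡ δ → γ≤ 3 1 m n (base m n ∸ δ)
      γ≤base∸ eq = subst (λ δ → γ≤ 3 1 m n (base m n ∸ δ)) eq (extendable⇒γ≤ E)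
  in (λ ∈Φ → γ≤base∸ (deficit-∈ m n ∈Φ)) , (λ ∉Φ → γ≤base∸ (deficit-∉ m n ∉Φ))
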